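{- Let $a_1,a_2,a_3,a_4\in\mathbb{Z}$ be such that $E: y^2+a_1xy+a_3y=x^3+a_2x^2+a_4x$ is an elliptic curve over $\mathbb{Q}$. Let $z=-x/y$ be the local parameter at the origin $O_E$. Then the $z$-power series expansion of the invariant differential $\omega_E$ is $\omega_E=\sum_{n=0}^{\infty}b(n+1)\,z^n\,dz$, where for every $n\ge 0$, \[b(n+1)=\sum_{m=\lfloor n/2\rfloor}^{n}\sum_{k=0}^{\lfloor m/2\rfloor}\sum_{r=0}^{n-m-k}\binom{m}{k}\binom{m-k}{k}\binom{m-2k}{r}\binom{k}{n-m-k-r}a_1^{m-2k-r}a_2^{r}a_3^{2k-n+m+r}a_4^{n-m-k-r}.\]
   Context: Setting $z=-x/y$ and $w=-1/y$, the Weierstrass equation becomes $w=z^3+a_1zw+a_2z^2w+a_3w^2+a_4zw^2$, which has a unique formal power series solution $w(z)=z^3+O(z^4)\in\mathbb{Z}[a_1,\dots,a_4]\llbracket z\rrbracket$. Then $x(z)=z/w(z)$ and $y(z)=-1/w(z)$ are Laurent series, and the invariant differential $\omega_E=\frac{dy}{3x^2+2a_2x+a_4-a_1y}=\frac{dx}{2y+a_1x+a_3}$ is expanded as a power series in $z$ times $dz$ by substituting these series. Binomial coefficients $\binom{a}{j}$ with $a\ge0$ are zero when $j<0$ or $j>a$ and empty sums are zero; any summand whose binomial coefficient product vanishes is interpreted as $0$. -}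

module Defs where

open import Data.Nat as ℕ using (ℕ; zero; suc; _∸_)
open import Data.Nat.DivMod using (_/_)
open import Data.Nat.Combinatorics using (_C_)
open import Data.Integer as ℤ using (ℤ; +_; _+_; _*_; _-_; -_; _^_)
open import Relation.Binary.PropositionalEquality using (_≡_; _≢_)
open import Data.Product using (_×_)

PowerSeries : Set
PowerSeries = ℕ → ℤ

sumBelow : ℕ → (ℕ → ℤ) → ℤ
sumBelow zero    f = + 0
sumBelow (suc n) f = sumBelow n f + f n

infixl 6 _⊕_ _⊖_
infixl 7 _⊛_ _·_
_⊕_ : PowerSeries → PowerSeries → PowerSeries
(f ⊕ g) n = f n + g n

_⊖_ : PowerSeries → PowerSeries → PowerSeries
(f ⊖ g) n = f n - g n

_⊛_ : PowerSeries → PowerSeries → PowerSeries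
(f ⊛ g) n = sumBelow (suc n) (λ i → f i * g (n ∸ i))

const : ℤ → PowerSeries
const c zero    = c
const c (suc n) = + 0

_·_ : ℤ → PowerSeries → PowerSeries
(c · f) n = c * f n

zmul : PowerSeries → PowerSeries
zmul f zero    = + 0
zmul f (suc n) = f n

zpow : ℕ → PowerSeries
zpow zero    = const (+ 1)
zpow (suc k) = zmul (zpow k)

zDeriv : PowerSeries → PowerSeries
zDeriv f n = + n * f n

-- Discriminant of y² + a₁xy + a₃y = x³ + a₂x² + a₄x  (a₆ = 0)
discriminant : ℤ → ℤ → ℤ → ℤ → ℤ
discriminant a₁ a₂ a₃ a₄ =
  - (b₂ * b₂ * b₈) - + 8 * (b₄ * b₄ * b₄) - + 27 * (b₆ * b₆) + + 9 * (b₂ * b₄ * b₆)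
  where
  b₂ = a₁ * a₁ + + 4 * a₂
  b₄ = + 2 * a₄ + a₁ * a₃
  b₆ = a₃ * a₃
  b₈ = a₂ * a₃ * a₃ - a₁ * a₃ * a₄ - a₄ * a₄

IsFormalW : ℤ → ℤ → ℤ → ℤ → PowerSeries → Set
IsFormalW a₁ a₂ a₃ a₄ w =
  (w 0 ≡ + 0) × (w 1 ≡ + 0) × (w 2 ≡ + 0) × (w 3 ≡ + 1) ×
  (∀ n → w n ≡ (zpow 3 ⊕ (a₁ · (zpow 1 ⊛ w)) ⊕ (a₂ · (zpow 2 ⊛ w))
                 ⊕ (a₃ · (w ⊛ w)) ⊕ (a₄ · (zpow 1 ⊛ (w ⊛ w)))) n)

-- With x = z/w, y = -1/w:  dx = (w - z w')/w² dz and
-- 2y + a₁x + a₃ = (-2 + a₁z + a₃w)/w, so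
-- ω_E = dx/(2y+a₁x+a₃) = (w - z w') / ((-2 + a₁z + a₃w) w) dz.
-- Numerator and denominator series:
ωNum : PowerSeries → PowerSeries
ωNum w = w ⊖ zDeriv w

ωDen : ℤ → ℤ → PowerSeries → PowerSeries
ωDen a₁ a₃ w = (const (- + 2) ⊕ (a₁ · zpow 1) ⊕ (a₃ · w)) ⊛ w

-- The coefficient b(n+1) of the paper (indexed here by n).
-- m ranges over ⌊n/2⌋ .. n, k over 0 .. ⌊m/2⌋, r over 0 .. n-m-k
-- (empty when m+k > n).  Exponent of a₃ is 2k-n+m+r; whenever it would be
-- negative the binomial (k choose n-m-k-r) vanishes, so truncated subtraction
-- gives the paper's convention.
bCoef : ℤ → ℤ → ℤ → ℤ → ℕ → ℤ
bCoef a₁ a₂ a₃ a₄ n =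
  sumBelow (suc n ∸ (n / 2)) λ i →
  let m = n / 2 ℕ.+ i in
  sumBelow (suc (m / 2)) λ k →
  sumBelow (suc n ∸ (m ℕ.+ k)) λ r →
    + ((m C k) ℕ.* ((m ∸ k) C k) ℕ.* ((m ∸ 2 ℕ.* k) C r) ℕ.* (k C (n ∸ m ∸ k ∸ r)))
    * (a₁ ^ (m ∸ 2 ℕ.* k ∸ r)) * (a₂ ^ r)
    * (a₃ ^ ((2 ℕ.* k ℕ.+ m ℕ.+ r) ∸ n)) * (a₄ ^ (n ∸ m ∸ k ∸ r))

{-# OPTIONS --safe #-}
module Submission where

-- Put E = z(a₁ + a₂z), F = z³(a₃ + a₄z), A = 1 - E, M = a₃ + a₄z and D = A² - 4F.
-- The curve equation reads M w² - A w + z³ = 0, so G = A - 2Mw satisfies G² = D, and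
-- differentiating it gives G (w - z w′) = (-2 + a₁z + a₃w) w, i.e. ω = dz / G.
-- The paper's coefficients are those of b = Σₖ C(2k,k) Fᵏ A^-(2k+1) = D^(-1/2): expanding
-- A^-(2k+1) = Σⱼ C(2k+j,2k) Eʲ and putting m = 2k + j gives the triple sum. This b solves
-- 2 D δb + (δD) b = 0 for δ = z d/dz, and then δ(bG) = 0 forces bG = 1, hence b = 1/G.
-- Infinite sums are truncated, so every identity is proved in ℤ⟦z⟧/(zᴺ) with N = n + 1.

open import Defs
open import Algebra.Bundles using (CommutativeRing)
open import Algebra.Solver.Ring.AlmostCommutativeRing using (_-Raw-AlmostCommutative⟶_; fromCommutativeRing)
open import Data.Integer as ℤ using (ℤ; +_; -_; _^_)
import Data.Integer.Properties as ℤₚ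
open import Data.Integer.Tactic.RingSolver using (solve-∀)
open import Data.Maybe using (Maybe; just; nothing)
open import Data.Nat as ℕ using (ℕ; zero; suc; _∸_; _<_; _≤_; z≤n; s≤s)
open import Data.Nat.Combinatorics using (_C_; nCk+nC[k+1]≡[n+1]C[k+1]; nCn≡1; k>n⇒nCk≡0)
open import Data.Nat.DivMod using (_/_; m/n≤m; m/n*n≤m; /-monoˡ-≤; m*n/n≡m)
open import Data.Nat.Induction using (<-rec)
import Data.Nat.Properties as ℕₚ
import Data.Nat.Tactic.RingSolver as ℕ-Solver
open import Data.Product using (_,_)
open import Data.Sum using ([_,_])
open import Function.Base using (_⟨_⟩_; id)
open import Relation.Nullary using (yes; no; contradiction)
open import Relation.Binary.PropositionalEquality
  using (_≡_; _≢_; _≗_; refl; sym; trans; cong; cong₂; subst; module ≡-Reasoning)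

module Binomial where
  open import Data.Nat using (ℕ; suc; _+_; _*_; _∸_; _≤_; _!; z≤n)
  open import Data.Nat.Properties
  open import Data.Nat.Combinatorics using (nCk≡n!/k![n-k]!; k![n∸k]!∣n!; nCk≡nC[n∸k])
  open import Data.Nat.DivMod using (m/n*n≡m)

  nC0≡1 : ∀ n → n C 0 ≡ 1
  nC0≡1 n = nCk≡nC[n∸k] {n = n} (z≤n {n}) ⟨ trans ⟩ nCn≡1 n

  [m+n]Cm*m!*n!≡[m+n]! : ∀ m n → ((m + n) C m) * (m ! * n !) ≡ (m + n) !
  [m+n]Cm*m!*n!≡[m+n]! m n = begin
    ((m + n) C m) * (m ! * n !)               ≡⟨ cong (λ k → ((m + n) C m) * (m ! * k !)) (sym (m+n∸m≡n m n)) ⟩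
    ((m + n) C m) * (m ! * (m + n ∸ m) !)     ≡⟨ cong (_* (m ! * (m + n ∸ m) !)) (nCk≡n!/k![n-k]! (m≤m+n m n)) ⟩
    _                                         ≡⟨ m/n*n≡m {{m !* (m + n ∸ m) !≢0}} (k![n∸k]!∣n! (m≤m+n m n)) ⟩
    (m + n) !                                 ∎
    where open ≡-Reasoning

  [m+1+n]Cm*[1+n]≡[1+m]*[1+m+n]C[1+m] : ∀ m n →
    ((m + suc n) C m) * suc n ≡ suc m * ((suc m + n) C suc m)
  [m+1+n]Cm*[1+n]≡[1+m]*[1+m+n]C[1+m] m n = *-cancelʳ-≡ _ _ (m ! * n !) {{m !* n !≢0}} (begin
    ((m + suc n) C m) * suc n * (m ! * n !)         ≡⟨ regroupˡ ((m + suc n) C m) (suc n) (m !) (n !) ⟩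
    ((m + suc n) C m) * (m ! * suc n !)             ≡⟨ [m+n]Cm*m!*n!≡[m+n]! m (suc n) ⟩
    (m + suc n) !                                   ≡⟨ cong _! (+-suc m n) ⟩
    (suc m + n) !                                   ≡⟨ [m+n]Cm*m!*n!≡[m+n]! (suc m) n ⟨
    ((suc m + n) C suc m) * (suc m ! * n !)         ≡⟨ regroupʳ ((suc m + n) C suc m) (suc m) (m !) (n !) ⟩
    suc m * ((suc m + n) C suc m) * (m ! * n !)     ∎)
    where
    open ≡-Reasoning
    regroupˡ : ∀ c s a b → c * s * (a * b) ≡ c * (a * (s * b))
    regroupˡ = ℕ-Solver.solve-∀
    regroupʳ : ∀ c s a b → c * ((s * a) * b) ≡ s * c * (a * b)
    regroupʳ = ℕ-Solver.solve-∀

  [1+n]*[2+2n]C[1+n]≡2*[1+2n]*[2n]Cn : ∀ n →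
    suc n * ((2 * suc n) C suc n) ≡ 2 * suc (2 * n) * ((2 * n) C n)
  [1+n]*[2+2n]C[1+n]≡2*[1+2n]*[2n]Cn n = *-cancelʳ-≡ _ _ (suc n * (n ! * n !)) {{factorials≢0}} (begin
    suc n * ((2 * suc n) C suc n) * (suc n * (n ! * n !))           ≡⟨ cong (λ m → suc n * (m C suc n) * (suc n * (n ! * n !))) (double (suc n)) ⟩
    suc n * ((suc n + suc n) C suc n) * (suc n * (n ! * n !))       ≡⟨ regroupˡ ((suc n + suc n) C suc n) n (n !) ⟩
    ((suc n + suc n) C suc n) * (suc n ! * suc n !)                 ≡⟨ [m+n]Cm*m!*n!≡[m+n]! (suc n) (suc n) ⟩
    (suc n + suc n) !                                               ≡⟨ cong _! (+-suc (suc n) n) ⟩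
    suc (suc n + n) * (suc (n + n) * (n + n) !)                     ≡⟨ cong (λ m → suc (suc n + n) * (suc (n + n) * m)) ([m+n]Cm*m!*n!≡[m+n]! n n) ⟨
    suc (suc n + n) * (suc (n + n) * (((n + n) C n) * (n ! * n !))) ≡⟨ regroupʳ ((n + n) C n) n (n !) ⟩
    2 * suc (n + n) * ((n + n) C n) * (suc n * (n ! * n !))         ≡⟨ cong (λ m → 2 * suc m * (m C n) * (suc n * (n ! * n !))) (double n) ⟨
    2 * suc (2 * n) * ((2 * n) C n) * (suc n * (n ! * n !))         ∎)
    where
    open ≡-Reasoning
    factorials≢0 = m*n≢0 (suc n) (n ! * n !) {{_}} {{n !* n !≢0}}
    double : ∀ m → 2 * m ≡ m + m
    double m = cong (_+_ m) (+-identityʳ m)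
    regroupˡ : ∀ c n f → suc n * c * (suc n * (f * f)) ≡ c * ((suc n * f) * (suc n * f))
    regroupˡ = ℕ-Solver.solve-∀
    regroupʳ : ∀ c n f → suc (suc n + n) * (suc (n + n) * (c * (f * f))) ≡ 2 * suc (n + n) * c * (suc n * (f * f))
    regroupʳ = ℕ-Solver.solve-∀

  mCk*[m∸k]Ck≡[2k]Ck*mC[2k] : ∀ {m k} → 2 * k ≤ m → (m C k) * ((m ∸ k) C k) ≡ ((2 * k) C k) * (m C (2 * k))
  mCk*[m∸k]Ck≡[2k]Ck*mC[2k] {m} {k} 2k≤m = *-cancelʳ-≡ _ _ (k ! * k ! * j !) {{factorials≢0}} (begin
    (m C k) * ((m ∸ k) C k) * (k ! * k ! * j !)                     ≡⟨ cong₂ (λ a b → (a C k) * (b C k) * (k ! * k ! * j !)) m≡k+[k+j] m∸k≡k+j ⟩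
    ((k + (k + j)) C k) * ((k + j) C k) * (k ! * k ! * j !)         ≡⟨ regroupˡ ((k + (k + j)) C k) ((k + j) C k) (k !) (j !) ⟩
    ((k + (k + j)) C k) * (k ! * (((k + j) C k) * (k ! * j !)))     ≡⟨ cong (λ x → ((k + (k + j)) C k) * (k ! * x)) ([m+n]Cm*m!*n!≡[m+n]! k j) ⟩
    ((k + (k + j)) C k) * (k ! * (k + j) !)                         ≡⟨ [m+n]Cm*m!*n!≡[m+n]! k (k + j) ⟩
    (k + (k + j)) !                                                 ≡⟨ cong _! (+-assoc k k j) ⟨
    (k + k + j) !                                                   ≡⟨ [m+n]Cm*m!*n!≡[m+n]! (k + k) j ⟨
    ((k + k + j) C (k + k)) * ((k + k) ! * j !)                     ≡⟨ cong (λ x → ((k + k + j) C (k + k)) * (x * j !)) ([m+n]Cm*m!*n!≡[m+n]! k k) ⟨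
    ((k + k + j) C (k + k)) * (((k + k) C k) * (k ! * k !) * j !)   ≡⟨ regroupʳ ((k + k + j) C (k + k)) ((k + k) C k) (k !) (j !) ⟩
    ((k + k) C k) * ((k + k + j) C (k + k)) * (k ! * k ! * j !)     ≡⟨ cong₂ (λ a b → (a C k) * (b C a) * (k ! * k ! * j !)) (sym 2k≡k+k) (sym m≡k+k+j) ⟩
    ((2 * k) C k) * (m C (2 * k)) * (k ! * k ! * j !)               ∎)
    where
    open ≡-Reasoning
    j = m ∸ 2 * k
    factorials≢0 = m*n≢0 (k ! * k !) (j !) {{k !* k !≢0}} {{j !≢0}}
    2k≡k+k : 2 * k ≡ k + k
    2k≡k+k = cong (_+_ k) (+-identityʳ k)
    m≡k+k+j : m ≡ k + k + j
    m≡k+k+j = sym (m+[n∸m]≡n 2k≤m) ⟨ trans ⟩ cong (_+ j) 2k≡k+k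
    m≡k+[k+j] : m ≡ k + (k + j)
    m≡k+[k+j] = m≡k+k+j ⟨ trans ⟩ +-assoc k k j
    m∸k≡k+j : m ∸ k ≡ k + j
    m∸k≡k+j = cong (_∸ k) m≡k+[k+j] ⟨ trans ⟩ m+n∸m≡n k (k + j)
    regroupˡ : ∀ a b f g → a * b * (f * f * g) ≡ a * (f * (b * (f * g)))
    regroupˡ = ℕ-Solver.solve-∀
    regroupʳ : ∀ a c f g → a * (c * (f * f) * g) ≡ c * a * (f * f * g)
    regroupʳ = ℕ-Solver.solve-∀

open Binomial
open import Data.Integer using (_+_; _*_)

-- Finite sums

sumBelow-cong : ∀ n {f g : ℕ → ℤ} → (∀ i → i < n → f i ≡ g i) → sumBelow n f ≡ sumBelow n g
sumBelow-cong zero    f≡g = refl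
sumBelow-cong (suc n) f≡g =
  cong₂ _+_ (sumBelow-cong n (λ i i<n → f≡g i (ℕₚ.m<n⇒m<1+n i<n))) (f≡g n ℕₚ.≤-refl)

sumBelow-zero : ∀ n {f : ℕ → ℤ} → (∀ i → i < n → f i ≡ + 0) → sumBelow n f ≡ + 0
sumBelow-zero n f≡0 = sumBelow-cong n f≡0 ⟨ trans ⟩ zeros n
  where
  zeros : ∀ n → sumBelow n (λ _ → + 0) ≡ + 0
  zeros zero    = refl
  zeros (suc n) = cong (_+ + 0) (zeros n)

sumBelow-distrib-+ : ∀ n (f g : ℕ → ℤ) →
  sumBelow n (λ i → f i + g i) ≡ sumBelow n f + sumBelow n g
sumBelow-distrib-+ zero    f g = refl
sumBelow-distrib-+ (suc n) f g =
  cong (_+ (f n + g n)) (sumBelow-distrib-+ n f g) ⟨ trans ⟩ interchange (sumBelow n f) (sumBelow n g) (f n) (g n)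
  where
  interchange : ∀ a b c d → (a + b) + (c + d) ≡ (a + c) + (b + d)
  interchange = solve-∀

*-distribˡ-sumBelow : ∀ n c (f : ℕ → ℤ) → c * sumBelow n f ≡ sumBelow n (λ i → c * f i)
*-distribˡ-sumBelow zero    c f = ℤₚ.*-zeroʳ c
*-distribˡ-sumBelow (suc n) c f =
  ℤₚ.*-distribˡ-+ c (sumBelow n f) (f n) ⟨ trans ⟩ cong (_+ c * f n) (*-distribˡ-sumBelow n c f)

sumBelow-swap : ∀ m n (f : ℕ → ℕ → ℤ) →
  sumBelow m (λ i → sumBelow n (f i)) ≡ sumBelow n (λ j → sumBelow m (λ i → f i j))
sumBelow-swap zero    n f = sym (sumBelow-zero n (λ _ _ → refl))
sumBelow-swap (suc m) n f =
  cong (_+ sumBelow n (f m)) (sumBelow-swap m n f)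
  ⟨ trans ⟩ sym (sumBelow-distrib-+ n (λ j → sumBelow m (λ i → f i j)) (f m))

sumBelow-head : ∀ n (f : ℕ → ℤ) → sumBelow (suc n) f ≡ f 0 + sumBelow n (λ i → f (suc i))
sumBelow-head zero    f = ℤₚ.+-comm (+ 0) (f 0)
sumBelow-head (suc n) f = cong (_+ f (suc n)) (sumBelow-head n f) ⟨ trans ⟩ ℤₚ.+-assoc (f 0) _ _

sumBelow-split : ∀ m n (f : ℕ → ℤ) →
  sumBelow (m ℕ.+ n) f ≡ sumBelow m f + sumBelow n (λ i → f (m ℕ.+ i))
sumBelow-split m zero    f = cong (λ k → sumBelow k f) (ℕₚ.+-identityʳ m) ⟨ trans ⟩ sym (ℤₚ.+-identityʳ (sumBelow m f))
sumBelow-split m (suc n) f = begin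
  sumBelow (m ℕ.+ suc n) f                                   ≡⟨ cong (λ k → sumBelow k f) (ℕₚ.+-suc m n) ⟩
  sumBelow (m ℕ.+ n) f + f (m ℕ.+ n)                          ≡⟨ cong (_+ f (m ℕ.+ n)) (sumBelow-split m n f) ⟩
  sumBelow m f + sumBelow n (λ i → f (m ℕ.+ i)) + f (m ℕ.+ n) ≡⟨ ℤₚ.+-assoc (sumBelow m f) _ _ ⟩
  sumBelow m f + sumBelow (suc n) (λ i → f (m ℕ.+ i))         ∎
  where open ≡-Reasoning

sumBelow-dropˡ : ∀ m n {f : ℕ → ℤ} → (∀ i → i < m → f i ≡ + 0) →
  sumBelow (m ℕ.+ n) f ≡ sumBelow n (λ i → f (m ℕ.+ i))
sumBelow-dropˡ m n {f} f≡0 =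
  sumBelow-split m n f ⟨ trans ⟩ cong (_+ rest) (sumBelow-zero m f≡0) ⟨ trans ⟩ ℤₚ.+-identityˡ rest
  where rest = sumBelow n (λ i → f (m ℕ.+ i))

sumBelow-dropʳ : ∀ {m n} {f : ℕ → ℤ} → m ≤ n → (∀ i → m ≤ i → i < n → f i ≡ + 0) →
  sumBelow n f ≡ sumBelow m f
sumBelow-dropʳ {m} {n} {f} m≤n f≡0 = begin
  sumBelow n f                                           ≡⟨ cong (λ k → sumBelow k f) (sym (ℕₚ.m+[n∸m]≡n m≤n)) ⟩
  sumBelow (m ℕ.+ (n ∸ m)) f                             ≡⟨ sumBelow-split m (n ∸ m) f ⟩
  sumBelow m f + sumBelow (n ∸ m) (λ i → f (m ℕ.+ i))   ≡⟨ cong (_+_ (sumBelow m f)) (sumBelow-zero (n ∸ m) tail≡0) ⟩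
  sumBelow m f + + 0                                     ≡⟨ ℤₚ.+-identityʳ _ ⟩
  sumBelow m f                                           ∎
  where
  open ≡-Reasoning
  tail≡0 : ∀ i → i < n ∸ m → f (m ℕ.+ i) ≡ + 0
  tail≡0 i i<n∸m = f≡0 (m ℕ.+ i) (ℕₚ.m≤m+n m i) (ℕₚ.<-≤-trans (ℕₚ.+-monoʳ-< m i<n∸m) (ℕₚ.≤-reflexive (ℕₚ.m+[n∸m]≡n m≤n)))

sumBelow-reverse : ∀ n (f : ℕ → ℤ) → sumBelow (suc n) f ≡ sumBelow (suc n) (λ i → f (n ∸ i))
sumBelow-reverse zero    f = refl
sumBelow-reverse (suc n) f = begin
  sumBelow (suc (suc n)) f                                    ≡⟨ sumBelow-head (suc n) f ⟩
  f 0 + sumBelow (suc n) (λ i → f (suc i))                    ≡⟨ cong (_+_ (f 0)) (sumBelow-reverse n (λ i → f (suc i))) ⟩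
  f 0 + sumBelow (suc n) (λ i → f (suc (n ∸ i)))              ≡⟨ ℤₚ.+-comm (f 0) _ ⟩
  sumBelow (suc n) (λ i → f (suc (n ∸ i))) + f 0              ≡⟨ cong₂ _+_ (sumBelow-cong (suc n) λ i i≤n →
                                                                    cong f (sym (ℕₚ.+-∸-assoc 1 (ℕₚ.≤-pred i≤n))))
                                                                  (cong f (sym (ℕₚ.n∸n≡0 (suc n)))) ⟩
  sumBelow (suc (suc n)) (λ i → f (suc n ∸ i))                ∎
  where open ≡-Reasoning

sumBelow-antidiagonal : ∀ n (f : ℕ → ℕ → ℤ) →
  sumBelow (suc n) (λ i → sumBelow (suc (n ∸ i)) (f i)) ≡
  sumBelow (suc n) (λ s → sumBelow (suc s) (λ i → f i (s ∸ i)))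
sumBelow-antidiagonal zero    f = refl
sumBelow-antidiagonal (suc n) f = begin
  sumBelow (suc n) (λ i → sumBelow (suc (suc n ∸ i)) (f i)) + sumBelow (suc (n ∸ n)) (f (suc n))
    ≡⟨ cong₂ _+_ (sumBelow-cong (suc n) λ i i≤n → cong (λ k → sumBelow (suc k) (f i)) (ℕₚ.+-∸-assoc 1 (ℕₚ.≤-pred i≤n)))
                 (cong (λ k → sumBelow (suc k) (f (suc n))) (ℕₚ.n∸n≡0 n)) ⟩
  sumBelow (suc n) (λ i → sumBelow (suc (n ∸ i)) (f i) + f i (suc (n ∸ i))) + (+ 0 + f (suc n) 0)
    ≡⟨ cong (_+ (+ 0 + f (suc n) 0)) (sumBelow-distrib-+ (suc n) _ _) ⟩
  sumBelow (suc n) (λ i → sumBelow (suc (n ∸ i)) (f i)) + sumBelow (suc n) (λ i → f i (suc (n ∸ i))) + (+ 0 + f (suc n) 0)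
    ≡⟨ cong₂ (λ a b → a + b + (+ 0 + f (suc n) 0)) (sumBelow-antidiagonal n f)
             (sumBelow-cong (suc n) λ i i≤n → cong (f i) (sym (ℕₚ.+-∸-assoc 1 (ℕₚ.≤-pred i≤n)))) ⟩
  R + sumBelow (suc n) (λ i → f i (suc n ∸ i)) + (+ 0 + f (suc n) 0)
    ≡⟨ regroup R _ _ ⟩
  R + (sumBelow (suc n) (λ i → f i (suc n ∸ i)) + f (suc n) 0)
    ≡⟨ cong (λ k → R + (sumBelow (suc n) (λ i → f i (suc n ∸ i)) + f (suc n) k)) (sym (ℕₚ.n∸n≡0 n)) ⟩
  R + sumBelow (suc (suc n)) (λ i → f i (suc n ∸ i))
    ∎
  where
  open ≡-Reasoning
  R = sumBelow (suc n) (λ s → sumBelow (suc s) (λ i → f i (s ∸ i)))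
  regroup : ∀ x y z → x + y + (+ 0 + z) ≡ x + (y + z)
  regroup = solve-∀

sumBelow-telescope : ∀ n (y : ℕ → ℤ) → sumBelow n (λ k → y k + - y (suc k)) ≡ y 0 + - y n
sumBelow-telescope zero    y = sym (ℤₚ.+-inverseʳ (y 0))
sumBelow-telescope (suc n) y =
  cong (_+ (y n + - y (suc n))) (sumBelow-telescope n y) ⟨ trans ⟩ cancel (y 0) (y n) (y (suc n))
  where
  cancel : ∀ a b c → a + - b + (b + - c) ≡ a + - c
  cancel = solve-∀

<∸⇒+≤ : ∀ {r x n} → r < suc n ∸ x → r ℕ.+ x ≤ n
<∸⇒+≤ {r} {x} {n} r<1+n∸x with x ℕₚ.≤? suc n
... | yes x≤1+n = ℕₚ.≤-pred (ℕₚ.m≤o∸n⇒m+n≤o (suc r) x≤1+n r<1+n∸x)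
... | no  x≰1+n = contradiction (subst (r <_) (ℕₚ.m≤n⇒m∸n≡0 (ℕₚ.<⇒≤ (ℕₚ.≰⇒> x≰1+n))) r<1+n∸x) ℕₚ.n≮0

-- Power series modulo zᴺ

neg : PowerSeries → PowerSeries
neg f n = - f n

-- 0ₛ is const (+ 0) rather than λ _ → + 0 so that it is the solver's constant con (+ 0).
0ₛ 1ₛ : PowerSeries
0ₛ = const (+ 0)
1ₛ = const (+ 1)

0ₛ-coeff : ∀ n → 0ₛ n ≡ + 0
0ₛ-coeff zero    = refl
0ₛ-coeff (suc n) = refl

Z : PowerSeries
Z = zpow 1

infixr 8 _^ₛ_
_^ₛ_ : PowerSeries → ℕ → PowerSeries
f ^ₛ zero  = 1ₛ
f ^ₛ suc k = f ⊛ f ^ₛ k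

⊛-comm : ∀ f g → f ⊛ g ≗ g ⊛ f
⊛-comm f g n = sumBelow-reverse n _ ⟨ trans ⟩ sumBelow-cong (suc n) λ i i≤n →
  cong (λ j → f (n ∸ i) * g j) (ℕₚ.m∸[m∸n]≡n (ℕₚ.≤-pred i≤n)) ⟨ trans ⟩ ℤₚ.*-comm (f (n ∸ i)) (g i)

const-⊛ : ∀ c f → const c ⊛ f ≗ c · f
const-⊛ c f n =
  sumBelow-head n _ ⟨ trans ⟩ cong (_+_ (c * f n)) (sumBelow-zero n λ _ _ → refl) ⟨ trans ⟩ ℤₚ.+-identityʳ _

⊛-identityˡ : ∀ f → 1ₛ ⊛ f ≗ f
⊛-identityˡ f n = const-⊛ (+ 1) f n ⟨ trans ⟩ ℤₚ.*-identityˡ (f n)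

⊛-distribˡ-⊕ : ∀ f g h → f ⊛ (g ⊕ h) ≗ f ⊛ g ⊕ f ⊛ h
⊛-distribˡ-⊕ f g h n =
  sumBelow-cong (suc n) (λ i _ → ℤₚ.*-distribˡ-+ (f i) _ _) ⟨ trans ⟩ sumBelow-distrib-+ (suc n) _ _

⊛-assoc : ∀ f g h → (f ⊛ g) ⊛ h ≗ f ⊛ (g ⊛ h)
⊛-assoc f g h n = sym (begin
  sumBelow (suc n) (λ i → f i * sumBelow (suc (n ∸ i)) (λ j → g j * h (n ∸ i ∸ j)))
    ≡⟨ sumBelow-cong (suc n) (λ i _ → *-distribˡ-sumBelow (suc (n ∸ i)) (f i) _) ⟩
  sumBelow (suc n) (λ i → sumBelow (suc (n ∸ i)) (λ j → f i * (g j * h (n ∸ i ∸ j))))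
    ≡⟨ sumBelow-antidiagonal n _ ⟩
  sumBelow (suc n) (λ s → sumBelow (suc s) (λ i → f i * (g (s ∸ i) * h (n ∸ i ∸ (s ∸ i)))))
    ≡⟨ sumBelow-cong (suc n) (λ s s≤n → sumBelow-cong (suc s) λ i i≤s →
         cong (λ m → f i * (g (s ∸ i) * h m)) (∸-∸-cancel (ℕₚ.≤-pred s≤n) (ℕₚ.≤-pred i≤s))
         ⟨ trans ⟩ sym (ℤₚ.*-assoc (f i) _ _)) ⟩
  sumBelow (suc n) (λ s → sumBelow (suc s) (λ i → f i * g (s ∸ i) * h (n ∸ s)))
    ≡⟨ sumBelow-cong (suc n) (λ s _ → sym (*-distribʳ-sumBelow (suc s) (h (n ∸ s)) _)) ⟩
  ((f ⊛ g) ⊛ h) n ∎)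
  where
  open ≡-Reasoning
  *-distribʳ-sumBelow : ∀ m c (u : ℕ → ℤ) → sumBelow m u * c ≡ sumBelow m (λ i → u i * c)
  *-distribʳ-sumBelow m c u = ℤₚ.*-comm (sumBelow m u) c ⟨ trans ⟩ *-distribˡ-sumBelow m c u
    ⟨ trans ⟩ sumBelow-cong m (λ i _ → ℤₚ.*-comm c (u i))
  ∸-∸-cancel : ∀ {n s i} → s ≤ n → i ≤ s → n ∸ i ∸ (s ∸ i) ≡ n ∸ s
  ∸-∸-cancel {n} {s} {i} s≤n i≤s =
    ℕₚ.∸-+-assoc n i (s ∸ i) ⟨ trans ⟩ cong (n ∸_) (ℕₚ.m+[n∸m]≡n i≤s)

const-* : ∀ a b → const (a * b) ≗ const a ⊛ const b
const-* a b zero    = sym (const-⊛ a (const b) zero)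
const-* a b (suc n) = sym (const-⊛ a (const b) (suc n) ⟨ trans ⟩ ℤₚ.*-zeroʳ a)

constℕ-+ : ∀ a b → const (+ (a ℕ.+ b)) ≗ const (+ a) ⊕ const (+ b)
constℕ-+ a b n = cong (λ c → const c n) (ℤₚ.pos-+ a b) ⟨ trans ⟩ const-+ (+ a) (+ b) n
  where
  const-+ : ∀ a b → const (a + b) ≗ const a ⊕ const b
  const-+ a b zero    = refl
  const-+ a b (suc n) = refl

constℕ-* : ∀ a b → const (+ (a ℕ.* b)) ≗ const (+ a) ⊛ const (+ b)
constℕ-* a b n = cong (λ c → const c n) (ℤₚ.pos-* a b) ⟨ trans ⟩ const-* (+ a) (+ b) n

zmul-⊛ : ∀ f g → zmul f ⊛ g ≗ zmul (f ⊛ g)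
zmul-⊛ f g zero    = refl
zmul-⊛ f g (suc n) = sumBelow-head (suc n) _ ⟨ trans ⟩ ℤₚ.+-identityˡ _

zmul≗Z⊛ : ∀ f → zmul f ≗ Z ⊛ f
zmul≗Z⊛ f zero    = refl
zmul≗Z⊛ f (suc n) = sym (zmul-⊛ 1ₛ f (suc n) ⟨ trans ⟩ ⊛-identityˡ f n)

infix 4 _≈[_]_
record _≈[_]_ (f : PowerSeries) (N : ℕ) (g : PowerSeries) : Set where
  constructor agreeBelow
  field agreement : ∀ n → n < N → f n ≡ g n
open _≈[_]_ public

≗⇒≈[] : ∀ {N f g} → f ≗ g → f ≈[ N ] g
≗⇒≈[] f≗g = agreeBelow (λ n _ → f≗g n)

⊛-cong : ∀ {N f f′ g g′} → f ≈[ N ] f′ → g ≈[ N ] g′ → f ⊛ g ≈[ N ] f′ ⊛ g′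
⊛-cong (agreeBelow f≈f′) (agreeBelow g≈g′) = agreeBelow λ n n<N → sumBelow-cong (suc n) λ i i≤n →
  cong₂ _*_ (f≈f′ i (ℕₚ.≤-<-trans (ℕₚ.≤-pred i≤n) n<N)) (g≈g′ (n ∸ i) (ℕₚ.≤-<-trans (ℕₚ.m∸n≤m n i) n<N))

truncatedSeriesRing : ℕ → CommutativeRing _ _
truncatedSeriesRing N = record
  { Carrier = PowerSeries
  ; _≈_ = _≈[ N ]_
  ; _+_ = _⊕_
  ; _*_ = _⊛_
  ; -_ = neg
  ; 0# = 0ₛ
  ; 1# = 1ₛ
  ; isCommutativeRing = record
    { isRing = record
      { +-isAbelianGroup = record
        { isGroup = record
          { isMonoid = record
            { isSemigroup = record
              { isMagma = record
                { isEquivalence = record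
                  { refl = agreeBelow λ _ _ → refl
                  ; sym = λ f≈g → agreeBelow λ n n<N → sym (agreement f≈g n n<N)
                  ; trans = λ f≈g g≈h → agreeBelow λ n n<N → trans (agreement f≈g n n<N) (agreement g≈h n n<N)
                  }
                ; ∙-cong = λ f≈f′ g≈g′ → agreeBelow λ n n<N →
                    cong₂ _+_ (agreement f≈f′ n n<N) (agreement g≈g′ n n<N)
                }
              ; assoc = λ f g h → ≗⇒≈[] λ n → ℤₚ.+-assoc (f n) (g n) (h n)
              }
            ; identity = (λ f → ≗⇒≈[] λ n → cong (_+ f n) (0ₛ-coeff n) ⟨ trans ⟩ ℤₚ.+-identityˡ (f n))
                     , (λ f → ≗⇒≈[] λ n → cong (_+_ (f n)) (0ₛ-coeff n) ⟨ trans ⟩ ℤₚ.+-identityʳ (f n))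
            }
          ; inverse = (λ f → ≗⇒≈[] λ n → ℤₚ.+-inverseˡ (f n) ⟨ trans ⟩ sym (0ₛ-coeff n))
                    , (λ f → ≗⇒≈[] λ n → ℤₚ.+-inverseʳ (f n) ⟨ trans ⟩ sym (0ₛ-coeff n))
          ; ⁻¹-cong = λ f≈g → agreeBelow λ n n<N → cong -_ (agreement f≈g n n<N)
          }
        ; comm = λ f g → ≗⇒≈[] λ n → ℤₚ.+-comm (f n) (g n)
        }
      ; *-cong = ⊛-cong
      ; *-assoc = λ f g h → ≗⇒≈[] (⊛-assoc f g h)
      ; *-identity = (λ f → ≗⇒≈[] (⊛-identityˡ f)) , (λ f → ≗⇒≈[] λ n → ⊛-comm f 1ₛ n ⟨ trans ⟩ ⊛-identityˡ f n)
      ; distrib = (λ f g h → ≗⇒≈[] (⊛-distribˡ-⊕ f g h))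
                , (λ f g h → ≗⇒≈[] λ n → ⊛-comm (g ⊕ h) f n ⟨ trans ⟩ ⊛-distribˡ-⊕ f g h n
                                          ⟨ trans ⟩ cong₂ _+_ (⊛-comm f g n) (⊛-comm f h n))
      }
    ; *-comm = λ f g → ≗⇒≈[] (⊛-comm f g)
    }
  }

module TruncatedSeriesSolver (N : ℕ) where

  private
    ring = fromCommutativeRing (truncatedSeriesRing N)

    constₕ : CommutativeRing.rawRing ℤₚ.+-*-commutativeRing -Raw-AlmostCommutative⟶ ring
    constₕ = record
      { ⟦_⟧ = const
      ; +-homo = λ a b → ≗⇒≈[] λ { zero → refl ; (suc n) → refl }
      ; *-homo = λ a b → ≗⇒≈[] (const-* a b)
      ; -‿homo = λ a → ≗⇒≈[] λ { zero → refl ; (suc n) → refl }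
      ; 0-homo = ≗⇒≈[] λ { zero → refl ; (suc n) → refl }
      ; 1-homo = ≗⇒≈[] λ { zero → refl ; (suc n) → refl }
      }

    _≟ₕ_ : ∀ a b → Maybe (const a ≈[ N ] const b)
    a ≟ₕ b with a ℤ.≟ b
    ... | yes refl = just (agreeBelow λ _ _ → refl)
    ... | no _     = nothing

  open import Algebra.Solver.Ring _ ring constₕ _≟ₕ_ public

module TruncatedSeriesReasoning (N : ℕ) where
  open CommutativeRing (truncatedSeriesRing N) public
    using (+-cong; *-cong; -‿cong) renaming (refl to ≈-refl; reflexive to ≈-reflexive; sym to ≈-sym; trans to ≈-trans)
  open import Relation.Binary.Reasoning.Setoid (CommutativeRing.setoid (truncatedSeriesRing N)) public
  open TruncatedSeriesSolver N public using (solve; _:=_; con; _:+_; _:*_; _:-_; :-_)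

  ⊕-congˡ : ∀ f {g g′} → g ≈[ N ] g′ → f ⊕ g ≈[ N ] f ⊕ g′
  ⊕-congˡ f = +-cong (≈-refl {f})

  ⊕-congʳ : ∀ g {f f′} → f ≈[ N ] f′ → f ⊕ g ≈[ N ] f′ ⊕ g
  ⊕-congʳ g f≈f′ = +-cong f≈f′ (≈-refl {g})

  ⊛-congˡ : ∀ f {g g′} → g ≈[ N ] g′ → f ⊛ g ≈[ N ] f ⊛ g′
  ⊛-congˡ f = *-cong (≈-refl {f})

  ⊛-congʳ : ∀ g {f f′} → f ≈[ N ] f′ → f ⊛ g ≈[ N ] f′ ⊛ g
  ⊛-congʳ g f≈f′ = *-cong f≈f′ (≈-refl {g})

module _ {N : ℕ} where
  open TruncatedSeriesReasoning N

  ^ₛ-cong : ∀ {f g} k → f ≈[ N ] g → f ^ₛ k ≈[ N ] g ^ₛ k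
  ^ₛ-cong zero    f≈g = ≈-refl
  ^ₛ-cong (suc k) f≈g = *-cong f≈g (^ₛ-cong k f≈g)

-- The derivation δ = z d/dz, order and degree

δ : PowerSeries → PowerSeries
δ = zDeriv

δ-cong : ∀ {N f g} → f ≈[ N ] g → δ f ≈[ N ] δ g
δ-cong f≈g = agreeBelow λ n n<N → cong (+ n *_) (agreement f≈g n n<N)

δ-⊕ : ∀ f g → δ (f ⊕ g) ≗ δ f ⊕ δ g
δ-⊕ f g n = ℤₚ.*-distribˡ-+ (+ n) (f n) (g n)

δ-neg : ∀ f → δ (neg f) ≗ neg (δ f)
δ-neg f n = sym (ℤₚ.neg-distribʳ-* (+ n) (f n))

δ-const : ∀ c → δ (const c) ≗ 0ₛ
δ-const c zero    = refl
δ-const c (suc n) = ℤₚ.*-zeroʳ (+ suc n)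

δ-Z : δ Z ≗ Z
δ-Z zero          = refl
δ-Z (suc zero)    = refl
δ-Z (suc (suc n)) = ℤₚ.*-zeroʳ (+ suc (suc n))

δ-⊛ : ∀ f g → δ (f ⊛ g) ≗ δ f ⊛ g ⊕ f ⊛ δ g
δ-⊛ f g n = begin
  + n * sumBelow (suc n) (λ i → f i * g (n ∸ i))
    ≡⟨ *-distribˡ-sumBelow (suc n) (+ n) _ ⟩
  sumBelow (suc n) (λ i → + n * (f i * g (n ∸ i)))
    ≡⟨ sumBelow-cong (suc n) (λ i i≤n → leibniz i (ℕₚ.≤-pred i≤n)) ⟩
  sumBelow (suc n) (λ i → + i * f i * g (n ∸ i) + f i * (+ (n ∸ i) * g (n ∸ i)))
    ≡⟨ sumBelow-distrib-+ (suc n) _ _ ⟩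
  (δ f ⊛ g ⊕ f ⊛ δ g) n ∎
  where
  open ≡-Reasoning
  split : ∀ a b x y → (a + b) * (x * y) ≡ a * x * y + x * (b * y)
  split = solve-∀
  leibniz : ∀ i → i ≤ n → + n * (f i * g (n ∸ i)) ≡ + i * f i * g (n ∸ i) + f i * (+ (n ∸ i) * g (n ∸ i))
  leibniz i i≤n =
    cong (λ m → + m * (f i * g (n ∸ i))) (sym (ℕₚ.m+[n∸m]≡n i≤n))
    ⟨ trans ⟩ cong (_* (f i * g (n ∸ i))) (ℤₚ.pos-+ i (n ∸ i))
    ⟨ trans ⟩ split (+ i) (+ (n ∸ i)) (f i) (g (n ∸ i))

δ-const⊛ : ∀ c f → δ (const c ⊛ f) ≗ const c ⊛ δ f
δ-const⊛ c f n =
  cong (+ n *_) (const-⊛ c f n) ⟨ trans ⟩ swap (+ n) c (f n) ⟨ trans ⟩ sym (const-⊛ c (δ f) n)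
  where
  swap : ∀ a b x → a * (b * x) ≡ b * (a * x)
  swap = solve-∀

module _ {N : ℕ} where
  open TruncatedSeriesReasoning N

  δ-^ₛ : ∀ f k → δ (f ^ₛ suc k) ≈[ N ] const (+ suc k) ⊛ (f ^ₛ k ⊛ δ f)
  δ-^ₛ f zero = begin
    δ (f ⊛ 1ₛ)                 ≈⟨ ≗⇒≈[] (δ-⊛ f 1ₛ) ⟩
    δ f ⊛ 1ₛ ⊕ f ⊛ δ 1ₛ        ≈⟨ ⊕-congˡ (δ f ⊛ 1ₛ) (⊛-congˡ f (≗⇒≈[] (δ-const (+ 1)))) ⟩
    δ f ⊛ 1ₛ ⊕ f ⊛ 0ₛ          ≈⟨ solve 2 (λ f df → df :* con (+ 1) :+ f :* con (+ 0) := con (+ 1) :* (con (+ 1) :* df)) ≈-refl f (δ f) ⟩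
    1ₛ ⊛ (1ₛ ⊛ δ f)            ∎
  δ-^ₛ f (suc k) = begin
    δ (f ⊛ f ^ₛ suc k)                                        ≈⟨ ≗⇒≈[] (δ-⊛ f (f ^ₛ suc k)) ⟩
    δ f ⊛ f ^ₛ suc k ⊕ f ⊛ δ (f ^ₛ suc k)                    ≈⟨ ⊕-congˡ (δ f ⊛ f ^ₛ suc k) (⊛-congˡ f (δ-^ₛ f k)) ⟩
    δ f ⊛ (f ⊛ f ^ₛ k) ⊕ f ⊛ (const (+ suc k) ⊛ (f ^ₛ k ⊛ δ f))
      ≈⟨ solve 4 (λ f fᵏ df s → df :* (f :* fᵏ) :+ f :* (s :* (fᵏ :* df)) := (con (+ 1) :+ s) :* ((f :* fᵏ) :* df))
               ≈-refl f (f ^ₛ k) (δ f) (const (+ suc k)) ⟩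
    (1ₛ ⊕ const (+ suc k)) ⊛ ((f ⊛ f ^ₛ k) ⊛ δ f)            ≈⟨ ⊛-congʳ ((f ⊛ f ^ₛ k) ⊛ δ f) (≗⇒≈[] λ n → sym (constℕ-+ 1 (suc k) n)) ⟩
    const (+ suc (suc k)) ⊛ (f ^ₛ suc k ⊛ δ f)              ∎

OrderAtLeast : ℕ → PowerSeries → Set
OrderAtLeast d f = ∀ n → n < d → f n ≡ + 0

⊛-order : ∀ {a b f g} → OrderAtLeast a f → OrderAtLeast b g → OrderAtLeast (a ℕ.+ b) (f ⊛ g)
⊛-order {a} {b} {f} {g} f₀ g₀ n n<a+b = sumBelow-zero (suc n) λ i i≤n → term i (ℕₚ.≤-pred i≤n)
  where
  term : ∀ i → i ≤ n → f i * g (n ∸ i) ≡ + 0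
  term i i≤n with i ℕₚ.<? a
  ... | yes i<a = cong (_* g (n ∸ i)) (f₀ i i<a)
  ... | no  i≮a = cong (f i *_) (g₀ (n ∸ i) n∸i<b) ⟨ trans ⟩ ℤₚ.*-zeroʳ (f i)
    where
    n∸i<b : n ∸ i < b
    n∸i<b = ℕₚ.+-cancelˡ-< i (n ∸ i) b
      (ℕₚ.≤-<-trans (ℕₚ.≤-reflexive (ℕₚ.m+[n∸m]≡n i≤n)) (ℕₚ.<-≤-trans n<a+b (ℕₚ.+-monoˡ-≤ b (ℕₚ.≮⇒≥ i≮a))))

^ₛ-order : ∀ {d f} k → OrderAtLeast d f → OrderAtLeast (k ℕ.* d) (f ^ₛ k)
^ₛ-order zero    f₀ n ()
^ₛ-order (suc k) f₀ = ⊛-order f₀ (^ₛ-order k f₀)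

δ-order : ∀ {d f} → OrderAtLeast d f → OrderAtLeast d (δ f)
δ-order f₀ n n<d = cong (+ n *_) (f₀ n n<d) ⟨ trans ⟩ ℤₚ.*-zeroʳ (+ n)

order-weaken : ∀ {a b f} → b ≤ a → OrderAtLeast a f → OrderAtLeast b f
order-weaken b≤a f₀ n n<b = f₀ n (ℕₚ.<-≤-trans n<b b≤a)

Z-order : OrderAtLeast 1 Z
Z-order zero    _           = refl
Z-order (suc n) (s≤s ())

order⇒≈0 : ∀ {N f} → OrderAtLeast N f → f ≈[ N ] 0ₛ
order⇒≈0 f₀ = agreeBelow λ n n<N → f₀ n n<N ⟨ trans ⟩ sym (0ₛ-coeff n)

⊕-order : ∀ {d f g} → OrderAtLeast d f → OrderAtLeast d g → OrderAtLeast d (f ⊕ g)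
⊕-order f₀ g₀ n n<d = cong₂ _+_ (f₀ n n<d) (g₀ n n<d)

const⊛-order : ∀ {d} c f → OrderAtLeast d f → OrderAtLeast d (const c ⊛ f)
const⊛-order c f f₀ = ⊛-order {0} {f = const c} (λ _ ()) f₀

DegreeAtMost : ℕ → PowerSeries → Set
DegreeAtMost d f = ∀ n → d < n → f n ≡ + 0

⊛-degree : ∀ {a b f g} → DegreeAtMost a f → DegreeAtMost b g → DegreeAtMost (a ℕ.+ b) (f ⊛ g)
⊛-degree {a} {b} {f} {g} f-deg g-deg n a+b<n = sumBelow-zero (suc n) λ i i≤n → term i (ℕₚ.≤-pred i≤n)
  where
  term : ∀ i → i ≤ n → f i * g (n ∸ i) ≡ + 0
  term i i≤n with a ℕₚ.<? i
  ... | yes a<i = cong (_* g (n ∸ i)) (f-deg i a<i)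
  ... | no  a≮i = cong (f i *_) (g-deg (n ∸ i) b<n∸i) ⟨ trans ⟩ ℤₚ.*-zeroʳ (f i)
    where
    b<n∸i : b < n ∸ i
    b<n∸i = ℕₚ.m+n≤o⇒m≤o∸n (suc b) (ℕₚ.≤-trans (ℕₚ.+-monoʳ-≤ (suc b) (ℕₚ.≮⇒≥ a≮i))
              (ℕₚ.≤-trans (ℕₚ.≤-reflexive (ℕₚ.+-comm (suc b) a ⟨ trans ⟩ ℕₚ.+-suc a b)) a+b<n))

^ₛ-degree : ∀ {d f} k → DegreeAtMost d f → DegreeAtMost (k ℕ.* d) (f ^ₛ k)
^ₛ-degree zero    f-deg (suc n) _ = refl
^ₛ-degree (suc k) f-deg = ⊛-degree f-deg (^ₛ-degree k f-deg)

⊕-degree : ∀ {d f g} → DegreeAtMost d f → DegreeAtMost d g → DegreeAtMost d (f ⊕ g)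
⊕-degree f-deg g-deg n d<n = cong₂ _+_ (f-deg n d<n) (g-deg n d<n)

const-degree : ∀ {d} c → DegreeAtMost d (const c)
const-degree c (suc n) _ = refl

Z-degree : DegreeAtMost 1 Z
Z-degree (suc zero)    (s≤s ())
Z-degree (suc (suc n)) _ = refl

linear-degree : ∀ α β → DegreeAtMost 1 (const α ⊕ const β ⊛ Z)
linear-degree α β = ⊕-degree (const-degree α) (⊛-degree {0} (const-degree β) Z-degree)

zpow-⊛-shift : ∀ d h m → (zpow d ⊛ h) (d ℕ.+ m) ≡ h m
zpow-⊛-shift zero    h m = ⊛-identityˡ h m
zpow-⊛-shift (suc d) h m = zmul-⊛ (zpow d) h (suc (d ℕ.+ m)) ⟨ trans ⟩ zpow-⊛-shift d h m

zpow-⊛-low : ∀ d h n → n < d → (zpow d ⊛ h) n ≡ + 0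
zpow-⊛-low (suc d) h zero    _         = zmul-⊛ (zpow d) h zero
zpow-⊛-low (suc d) h (suc n) (s≤s n<d) = zmul-⊛ (zpow d) h (suc n) ⟨ trans ⟩ zpow-⊛-low d h n n<d

module _ {N : ℕ} where
  open TruncatedSeriesReasoning N

  zpow-+ : ∀ a b → zpow (a ℕ.+ b) ≈[ N ] zpow a ⊛ zpow b
  zpow-+ zero    b = ≈-sym (≗⇒≈[] (⊛-identityˡ (zpow b)))
  zpow-+ (suc a) b = begin
    zmul (zpow (a ℕ.+ b))      ≈⟨ ≗⇒≈[] (zmul≗Z⊛ (zpow (a ℕ.+ b))) ⟩
    Z ⊛ zpow (a ℕ.+ b)         ≈⟨ ⊛-congˡ Z (zpow-+ a b) ⟩
    Z ⊛ (zpow a ⊛ zpow b)      ≈⟨ ≈-sym (≗⇒≈[] (⊛-assoc Z (zpow a) (zpow b))) ⟩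
    (Z ⊛ zpow a) ⊛ zpow b      ≈⟨ ⊛-congʳ (zpow b) (≈-sym (≗⇒≈[] (zmul≗Z⊛ (zpow a)))) ⟩
    zmul (zpow a) ⊛ zpow b     ∎

  zpow⊛-^ₛ : ∀ d f k → (zpow d ⊛ f) ^ₛ k ≈[ N ] zpow (k ℕ.* d) ⊛ f ^ₛ k
  zpow⊛-^ₛ d f zero    = solve 0 (con (+ 1) := con (+ 1) :* con (+ 1)) ≈-refl
  zpow⊛-^ₛ d f (suc k) = begin
    (zpow d ⊛ f) ⊛ (zpow d ⊛ f) ^ₛ k                 ≈⟨ ⊛-congˡ (zpow d ⊛ f) (zpow⊛-^ₛ d f k) ⟩
    (zpow d ⊛ f) ⊛ (zpow (k ℕ.* d) ⊛ f ^ₛ k)         ≈⟨ solve 4 (λ x f y fᵏ → (x :* f) :* (y :* fᵏ) := (x :* y) :* (f :* fᵏ))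
                                                          ≈-refl (zpow d) f (zpow (k ℕ.* d)) (f ^ₛ k) ⟩
    (zpow d ⊛ zpow (k ℕ.* d)) ⊛ (f ⊛ f ^ₛ k)        ≈⟨ ⊛-congʳ (f ⊛ f ^ₛ k) (≈-sym (zpow-+ d (k ℕ.* d))) ⟩
    zpow (suc k ℕ.* d) ⊛ f ^ₛ suc k                  ∎

Σₛ : ℕ → (ℕ → PowerSeries) → PowerSeries
Σₛ K g n = sumBelow K (λ k → g k n)

⊛-distribˡ-Σₛ : ∀ K f g → f ⊛ Σₛ K g ≗ Σₛ K (λ k → f ⊛ g k)
⊛-distribˡ-Σₛ K f g n =
  sumBelow-cong (suc n) (λ i _ → *-distribˡ-sumBelow K (f i) (λ k → g k (n ∸ i))) ⟨ trans ⟩ sumBelow-swap (suc n) K _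

δ-Σₛ : ∀ K g → δ (Σₛ K g) ≗ Σₛ K (λ k → δ (g k))
δ-Σₛ K g n = *-distribˡ-sumBelow K (+ n) (λ k → g k n)

Σₛ-distrib-⊕ : ∀ K g h → Σₛ K (λ k → g k ⊕ h k) ≗ Σₛ K g ⊕ Σₛ K h
Σₛ-distrib-⊕ K g h n = sumBelow-distrib-+ K (λ k → g k n) (λ k → h k n)

Σₛ-cong : ∀ {N} K {g h} → (∀ k → k < K → g k ≈[ N ] h k) → Σₛ K g ≈[ N ] Σₛ K h
Σₛ-cong K g≈h = agreeBelow λ n n<N → sumBelow-cong K λ k k<K → agreement (g≈h k k<K) n n<N

module _ {N : ℕ} where
  open TruncatedSeriesReasoning N

  Σₛ-telescoping : ∀ {g h} (y : ℕ → PowerSeries) →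
    (∀ k → g k ≈[ N ] h k ⊕ (y k ⊕ neg (y (suc k)))) → y 0 ≈[ N ] 0ₛ → OrderAtLeast N (y N) →
    Σₛ N g ≈[ N ] Σₛ N h
  Σₛ-telescoping {g} {h} y g≈h+Δy y₀≈0 yₙ≈0 = begin
    Σₛ N g                                           ≈⟨ Σₛ-cong N (λ k _ → g≈h+Δy k) ⟩
    Σₛ N (λ k → h k ⊕ (y k ⊕ neg (y (suc k))))     ≈⟨ ≗⇒≈[] (Σₛ-distrib-⊕ N h _) ⟩
    Σₛ N h ⊕ Σₛ N (λ k → y k ⊕ neg (y (suc k)))    ≈⟨ ⊕-congˡ (Σₛ N h) (≗⇒≈[] λ n → sumBelow-telescope N (λ k → y k n)) ⟩
    Σₛ N h ⊕ (y 0 ⊕ neg (y N))                      ≈⟨ ⊕-congˡ (Σₛ N h) (+-cong y₀≈0 (-‿cong (order⇒≈0 yₙ≈0))) ⟩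
    Σₛ N h ⊕ (0ₛ ⊕ neg 0ₛ)                          ≈⟨ solve 1 (λ s → s :+ (con (+ 0) :- con (+ 0)) := s) ≈-refl (Σₛ N h) ⟩
    Σₛ N h                                           ∎

module _ {N : ℕ} where
  open TruncatedSeriesReasoning N

  const-⊛-const : ∀ {a b c d} f → a ℕ.* b ≡ c ℕ.* d →
    const (+ a) ⊛ (const (+ b) ⊛ f) ≈[ N ] const (+ c) ⊛ (const (+ d) ⊛ f)
  const-⊛-const {a} {b} {c} {d} f ab≡cd = begin
    const (+ a) ⊛ (const (+ b) ⊛ f)   ≈⟨ ≗⇒≈[] (λ n → sym (⊛-assoc (const (+ a)) (const (+ b)) f n)) ⟩
    (const (+ a) ⊛ const (+ b)) ⊛ f   ≈⟨ ⊛-congʳ f (≗⇒≈[] λ n → sym (constℕ-* a b n) ⟨ trans ⟩ cong (λ m → const (+ m) n) ab≡cd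
                                                                  ⟨ trans ⟩ constℕ-* c d n) ⟩
    (const (+ c) ⊛ const (+ d)) ⊛ f   ≈⟨ ≗⇒≈[] (⊛-assoc (const (+ c)) (const (+ d)) f) ⟩
    const (+ c) ⊛ (const (+ d) ⊛ f)   ∎

module InverseBinomialSeries {N : ℕ} (E : PowerSeries) (E₀ : OrderAtLeast 1 E) where
  open TruncatedSeriesReasoning N

  -- (1 - E)^-(q+1) = Σⱼ C(q+j,q) Eʲ, truncated.
  P : ℕ → PowerSeries
  P q = Σₛ N (λ j → const (+ ((q ℕ.+ j) C q)) ⊛ E ^ₛ j)

  private
    E^ₛ-order : ∀ j → OrderAtLeast j (E ^ₛ j)
    E^ₛ-order j = order-weaken (ℕₚ.≤-reflexive (sym (ℕₚ.*-identityʳ j))) (^ₛ-order j E₀)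

  P-recurrence : ∀ q → (1ₛ ⊕ neg E) ⊛ P (suc q) ≈[ N ] P q
  P-recurrence q = begin
    (1ₛ ⊕ neg E) ⊛ P (suc q)                              ≈⟨ ≗⇒≈[] (⊛-distribˡ-Σₛ N (1ₛ ⊕ neg E) (λ j → const (+ c′ j) ⊛ E ^ₛ j)) ⟩
    Σₛ N (λ j → (1ₛ ⊕ neg E) ⊛ (const (+ c′ j) ⊛ E ^ₛ j)) ≈⟨ Σₛ-telescoping y term (≈-refl {0ₛ}) (y-order N) ⟩
    P q                                                   ∎
    where
    c′ : ℕ → ℕ
    c′ j = (suc q ℕ.+ j) C suc q
    y : ℕ → PowerSeries
    y zero    = 0ₛ
    y (suc j) = const (+ c′ j) ⊛ E ^ₛ suc j
    y-order : ∀ j → OrderAtLeast j (y j)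
    y-order zero    _ ()
    y-order (suc j) = const⊛-order (+ c′ j) _ (E^ₛ-order (suc j))
    pascal : ∀ j → c′ (suc j) ≡ (q ℕ.+ suc j) C q ℕ.+ c′ j
    pascal j = sym (nCk+nC[k+1]≡[n+1]C[k+1] (q ℕ.+ suc j) q)
      ⟨ trans ⟩ cong (λ m → (q ℕ.+ suc j) C q ℕ.+ (m C suc q)) (ℕₚ.+-suc q j)
    term : ∀ j → (1ₛ ⊕ neg E) ⊛ (const (+ c′ j) ⊛ E ^ₛ j) ≈[ N ]
                 const (+ ((q ℕ.+ j) C q)) ⊛ E ^ₛ j ⊕ (y j ⊕ neg (y (suc j)))
    term zero = begin
      (1ₛ ⊕ neg E) ⊛ (const (+ c′ 0) ⊛ 1ₛ)                                         ≈⟨ ⊛-congˡ (1ₛ ⊕ neg E) (⊛-congʳ 1ₛ (one (c′ 0) c′0≡1)) ⟩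
      (1ₛ ⊕ neg E) ⊛ (1ₛ ⊛ 1ₛ)                                                      ≈⟨ solve 1 (λ e → (con (+ 1) :- e) :* (con (+ 1) :* con (+ 1))
                                                                                        := con (+ 1) :* con (+ 1) :+ (con (+ 0) :- con (+ 1) :* (e :* con (+ 1)))) ≈-refl E ⟩
      1ₛ ⊛ 1ₛ ⊕ (0ₛ ⊕ neg (1ₛ ⊛ (E ⊛ 1ₛ)))                                          ≈⟨ +-cong (⊛-congʳ 1ₛ (≈-sym (one ((q ℕ.+ 0) C q) (cong (_C q) (ℕₚ.+-identityʳ q) ⟨ trans ⟩ nCn≡1 q))))
                                                                                        (⊕-congˡ 0ₛ (-‿cong (⊛-congʳ (E ⊛ 1ₛ) (≈-sym (one (c′ 0) c′0≡1))))) ⟩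
      const (+ ((q ℕ.+ 0) C q)) ⊛ 1ₛ ⊕ (0ₛ ⊕ neg (const (+ c′ 0) ⊛ (E ⊛ 1ₛ)))       ∎
      where
      one : ∀ m → m ≡ 1 → const (+ m) ≈[ N ] 1ₛ
      one m m≡1 = ≗⇒≈[] λ n → cong (λ k → const (+ k) n) m≡1
      c′0≡1 : c′ 0 ≡ 1
      c′0≡1 = cong (_C suc q) (ℕₚ.+-identityʳ (suc q)) ⟨ trans ⟩ nCn≡1 (suc q)
    term (suc j) = begin
      (1ₛ ⊕ neg E) ⊛ (const (+ c′ (suc j)) ⊛ Eʲ)                           ≈⟨ ⊛-congˡ (1ₛ ⊕ neg E) (⊛-congʳ Eʲ (≗⇒≈[] λ n →
                                                                                 cong (λ m → const (+ m) n) (pascal j) ⟨ trans ⟩ constℕ-+ a (c′ j) n)) ⟩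
      (1ₛ ⊕ neg E) ⊛ ((const (+ a) ⊕ const (+ c′ j)) ⊛ Eʲ)               ≈⟨ solve 4 (λ e x α β → (con (+ 1) :- e) :* ((α :+ β) :* x)
                                                                                 := α :* x :+ (β :* x :- (α :+ β) :* (e :* x))) ≈-refl E Eʲ (const (+ a)) (const (+ c′ j)) ⟩
      const (+ a) ⊛ Eʲ ⊕ (y (suc j) ⊕ neg ((const (+ a) ⊕ const (+ c′ j)) ⊛ (E ⊛ Eʲ)))
        ≈⟨ ⊕-congˡ (const (+ a) ⊛ Eʲ) (⊕-congˡ (y (suc j)) (-‿cong (⊛-congʳ (E ⊛ Eʲ) (≗⇒≈[] λ n →
             sym (constℕ-+ a (c′ j) n) ⟨ trans ⟩ cong (λ m → const (+ m) n) (sym (pascal j)))))) ⟩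
      const (+ a) ⊛ Eʲ ⊕ (y (suc j) ⊕ neg (y (suc (suc j))))                ∎
      where
      a = (q ℕ.+ suc j) C q
      Eʲ = E ^ₛ suc j

  δ-P : ∀ q → δ (P q) ≈[ N ] const (+ suc q) ⊛ (P (suc q) ⊛ δ E)
  δ-P q = begin
    δ (P q)                                ≈⟨ ≗⇒≈[] (δ-Σₛ N h) ⟩
    Σₛ N (λ j → δ (h j))                   ≈⟨ Σₛ-telescoping y term (≈-refl {0ₛ}) (y-order N) ⟩
    Σₛ N (λ j → s ⊛ (g j ⊛ δ E))           ≈⟨ ≈-sym (≗⇒≈[] (⊛-distribˡ-Σₛ N s (λ j → g j ⊛ δ E))) ⟩
    s ⊛ Σₛ N (λ j → g j ⊛ δ E)             ≈⟨ ⊛-congˡ s (≗⇒≈[] λ n → sumBelow-cong N λ j _ → ⊛-comm (g j) (δ E) n) ⟩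
    s ⊛ Σₛ N (λ j → δ E ⊛ g j)             ≈⟨ ⊛-congˡ s (≈-sym (≗⇒≈[] (⊛-distribˡ-Σₛ N (δ E) g))) ⟩
    s ⊛ (δ E ⊛ P (suc q))                  ≈⟨ ⊛-congˡ s (≗⇒≈[] (⊛-comm (δ E) (P (suc q)))) ⟩
    s ⊛ (P (suc q) ⊛ δ E)                  ∎
    where
    s = const (+ suc q)
    h g : ℕ → PowerSeries
    h j = const (+ ((q ℕ.+ j) C q)) ⊛ E ^ₛ j
    g j = const (+ ((suc q ℕ.+ j) C suc q)) ⊛ E ^ₛ j
    y : ℕ → PowerSeries
    y zero    = 0ₛ
    y (suc j) = const (+ ((q ℕ.+ suc j) C q)) ⊛ (const (+ suc j) ⊛ (E ^ₛ j ⊛ δ E))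
    y-order : ∀ j → OrderAtLeast j (y j)
    y-order zero    _ ()
    y-order (suc j) = const⊛-order _ _ (const⊛-order _ _ (order-weaken (ℕₚ.≤-reflexive (ℕₚ.+-comm 1 j))
                        (⊛-order (E^ₛ-order j) (δ-order E₀))))
    y≈ : ∀ j → y (suc j) ≈[ N ] s ⊛ (g j ⊛ δ E)
    y≈ j = begin
      y (suc j)                                                          ≈⟨ const-⊛-const (E ^ₛ j ⊛ δ E) ([m+1+n]Cm*[1+n]≡[1+m]*[1+m+n]C[1+m] q j) ⟩
      s ⊛ (const (+ ((suc q ℕ.+ j) C suc q)) ⊛ (E ^ₛ j ⊛ δ E))          ≈⟨ ⊛-congˡ s (≈-sym (≗⇒≈[] (⊛-assoc (const (+ ((suc q ℕ.+ j) C suc q))) (E ^ₛ j) (δ E)))) ⟩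
      s ⊛ (g j ⊛ δ E)                                                    ∎
    term : ∀ j → δ (h j) ≈[ N ] s ⊛ (g j ⊛ δ E) ⊕ (y j ⊕ neg (y (suc j)))
    term zero = begin
      δ (h 0)                                      ≈⟨ ≗⇒≈[] (δ-const⊛ (+ ((q ℕ.+ 0) C q)) 1ₛ) ⟩
      const (+ ((q ℕ.+ 0) C q)) ⊛ δ 1ₛ             ≈⟨ ⊛-congˡ (const (+ ((q ℕ.+ 0) C q))) (≗⇒≈[] (δ-const (+ 1))) ⟩
      const (+ ((q ℕ.+ 0) C q)) ⊛ 0ₛ               ≈⟨ solve 2 (λ c x → c :* con (+ 0) := x :+ (con (+ 0) :- x)) ≈-refl (const (+ ((q ℕ.+ 0) C q))) X ⟩
      X ⊕ (0ₛ ⊕ neg X)                             ≈⟨ ⊕-congˡ X (⊕-congˡ 0ₛ (-‿cong (≈-sym (y≈ 0)))) ⟩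
      X ⊕ (0ₛ ⊕ neg (y 1))                         ∎
      where X = s ⊛ (g 0 ⊛ δ E)
    term (suc j) = begin
      δ (h (suc j))                                ≈⟨ ≗⇒≈[] (δ-const⊛ (+ ((q ℕ.+ suc j) C q)) (E ^ₛ suc j)) ⟩
      const (+ ((q ℕ.+ suc j) C q)) ⊛ δ (E ^ₛ suc j)  ≈⟨ ⊛-congˡ (const (+ ((q ℕ.+ suc j) C q))) (δ-^ₛ E j) ⟩
      y (suc j)                                    ≈⟨ solve 2 (λ x y → y := x :+ (y :- x)) ≈-refl X (y (suc j)) ⟩
      X ⊕ (y (suc j) ⊕ neg X)                      ≈⟨ ⊕-congˡ X (⊕-congˡ (y (suc j)) (-‿cong (≈-sym (y≈ (suc j))))) ⟩
      X ⊕ (y (suc j) ⊕ neg (y (suc (suc j))))      ∎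
      where X = s ⊛ (g (suc j) ⊛ δ E)

⊛-cancelˡ : ∀ {N} D {u} → D 0 ≢ + 0 → D ⊛ u ≈[ N ] 0ₛ → u ≈[ N ] 0ₛ
⊛-cancelˡ {N} D {u} D₀≢0 Du≈0 = agreeBelow λ m m<N → <-rec _ coeff≡0 m m<N ⟨ trans ⟩ sym (0ₛ-coeff m)
  where
  coeff≡0 : ∀ m → (∀ {i} → i < m → i < N → u i ≡ + 0) → m < N → u m ≡ + 0
  coeff≡0 m earlier≡0 m<N = [ id , (λ D₀≡0 → contradiction D₀≡0 D₀≢0) ] (ℤₚ.i*j≡0⇒i≡0∨j≡0 (u m) leading≡0)
    where
    leading≡0 : u m * D 0 ≡ + 0
    leading≡0 = begin
      u m * D 0                                                    ≡⟨ cong (λ k → u m * D k) (ℕₚ.n∸n≡0 m) ⟨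
      u m * D (m ∸ m)                                              ≡⟨ ℤₚ.+-identityˡ _ ⟨
      + 0 + u m * D (m ∸ m)                                        ≡⟨ cong (_+ u m * D (m ∸ m)) (sumBelow-zero m λ i i<m →
                                                                        cong (_* D (m ∸ i)) (earlier≡0 i<m (ℕₚ.<-trans i<m m<N))) ⟨
      (u ⊛ D) m                                                    ≡⟨ ⊛-comm u D m ⟩
      (D ⊛ u) m                                                    ≡⟨ agreement Du≈0 m m<N ⟩
      0ₛ m                                                         ≡⟨ 0ₛ-coeff m ⟩
      + 0                                                          ∎
      where open ≡-Reasoning

δ≈0⇒≈const : ∀ {N h} → δ h ≈[ N ] 0ₛ → h ≈[ N ] const (h 0)
δ≈0⇒≈const {N} {h} δh≈0 = agreeBelow coeff
  where
  coeff : ∀ n → n < N → h n ≡ const (h 0) n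
  coeff zero    _   = refl
  coeff (suc n) n<N = [ (λ ()) , id ] (ℤₚ.i*j≡0⇒i≡0∨j≡0 (+ suc n) (agreement δh≈0 (suc n) n<N))

module _ {N : ℕ} where
  open TruncatedSeriesReasoning N

  2Dδb+[δD]b≈0⇒bG≈1 : ∀ D G b → G ⊛ G ≈[ N ] D → const (+ 2) ⊛ (D ⊛ δ b) ⊕ δ D ⊛ b ≈[ N ] 0ₛ →
                        b 0 * G 0 ≡ + 1 → b ⊛ G ≈[ N ] 1ₛ
  2Dδb+[δD]b≈0⇒bG≈1 D G b G²≈D ode b₀G₀≡1 = begin
    b ⊛ G             ≈⟨ δ≈0⇒≈const (⊛-cancelˡ (const (+ 2)) (λ ()) (⊛-cancelˡ G G₀≢0 (⊛-cancelˡ G G₀≢0 G²2δ[bG]≈0))) ⟩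
    const ((b ⊛ G) 0) ≈⟨ ≗⇒≈[] (λ n → cong (λ c → const c n) (ℤₚ.+-identityˡ (b 0 * G 0) ⟨ trans ⟩ b₀G₀≡1)) ⟩
    1ₛ                ∎
    where
    G₀≢0 : G 0 ≢ + 0
    G₀≢0 G₀≡0 = contradiction (sym b₀G₀≡1 ⟨ trans ⟩ cong (b 0 *_) G₀≡0 ⟨ trans ⟩ ℤₚ.*-zeroʳ (b 0)) (λ ())
    δD≈ : δ D ≈[ N ] δ G ⊛ G ⊕ G ⊛ δ G
    δD≈ = δ-cong (≈-sym G²≈D) ⟨ ≈-trans ⟩ ≗⇒≈[] (δ-⊛ G G)
    G²2δ[bG]≈0 : G ⊛ (G ⊛ (const (+ 2) ⊛ δ (b ⊛ G))) ≈[ N ] 0ₛ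
    G²2δ[bG]≈0 = begin
      G ⊛ (G ⊛ (const (+ 2) ⊛ δ (b ⊛ G)))                          ≈⟨ ⊛-congˡ G (⊛-congˡ G (⊛-congˡ (const (+ 2)) (≗⇒≈[] (δ-⊛ b G)))) ⟩
      G ⊛ (G ⊛ (const (+ 2) ⊛ (δ b ⊛ G ⊕ b ⊛ δ G)))                ≈⟨ solve 4 (λ g b δb δg →
                                                                         g :* (g :* (con (+ 2) :* (δb :* g :+ b :* δg)))
                                                                      := g :* (con (+ 2) :* ((g :* g) :* δb) :+ (δg :* g :+ g :* δg) :* b))
                                                                       ≈-refl G b (δ b) (δ G) ⟩
      G ⊛ (const (+ 2) ⊛ ((G ⊛ G) ⊛ δ b) ⊕ (δ G ⊛ G ⊕ G ⊛ δ G) ⊛ b) ≈⟨ ⊛-congˡ G (+-cong (⊛-congˡ (const (+ 2)) (⊛-congʳ (δ b) G²≈D))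
                                                                                          (⊛-congʳ b (≈-sym δD≈))) ⟩
      G ⊛ (const (+ 2) ⊛ (D ⊛ δ b) ⊕ δ D ⊛ b)                       ≈⟨ ⊛-congˡ G ode ⟩
      G ⊛ 0ₛ                                                        ≈⟨ solve 1 (λ g → g :* con (+ 0) := con (+ 0)) ≈-refl G ⟩
      0ₛ                                                            ∎

module WeierstrassCurve (a₁ a₂ a₃ a₄ : ℤ) where

  L M E F A D : PowerSeries
  L = const a₁ ⊕ const a₂ ⊛ Z
  M = const a₃ ⊕ const a₄ ⊛ Z
  E = Z ⊛ L
  F = Z ⊛ (Z ⊛ (Z ⊛ M))
  A = 1ₛ ⊕ neg E
  D = A ⊛ A ⊕ neg (const (+ 4) ⊛ F)

  E-order : OrderAtLeast 1 E
  E-order = ⊛-order {1} {0} {g = L} Z-order (λ _ ())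

  F-order : OrderAtLeast 3 F
  F-order = ⊛-order {1} Z-order (⊛-order {1} Z-order (⊛-order {1} {0} {g = M} Z-order (λ _ ())))

  module _ (w : PowerSeries) where

    curveRHS δcurveRHS : PowerSeries
    curveRHS  = Z ⊛ (Z ⊛ Z) ⊕ E ⊛ w ⊕ M ⊛ (w ⊛ w)
    δcurveRHS = const (+ 3) ⊛ (Z ⊛ (Z ⊛ Z)) ⊕ (Z ⊛ (const a₁ ⊕ const (+ 2) ⊛ (const a₂ ⊛ Z))) ⊛ w ⊕ E ⊛ δ w
                ⊕ (const a₄ ⊛ Z) ⊛ (w ⊛ w) ⊕ const (+ 2) ⊛ (M ⊛ (w ⊛ δ w))

    CurveEquation : ℕ → Set
    CurveEquation N = w ≈[ N ] curveRHS

    -- G is the square root of D singled out by w, and ωNum w / ωDen w = 1 / G.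
    G Q : PowerSeries
    G = A ⊕ neg (const (+ 2) ⊛ (M ⊛ w))
    Q = const (- + 2) ⊕ const a₁ ⊛ Z ⊕ const a₃ ⊛ w

    G₀≡1 : w 0 ≡ + 0 → G 0 ≡ + 1
    G₀≡1 w₀≡0 rewrite w₀≡0 | ℤₚ.*-zeroʳ (M 0) = refl

  module _ {N : ℕ} (w : PowerSeries) where
    open TruncatedSeriesReasoning N

    IsFormalW⇒CurveEquation : IsFormalW a₁ a₂ a₃ a₄ w → CurveEquation w N
    IsFormalW⇒CurveEquation (_ , _ , _ , _ , w-rec) = begin
      w                                                                    ≈⟨ ≗⇒≈[] w-rec ⟩
      zpow 3 ⊕ a₁ · (Z ⊛ w) ⊕ a₂ · (zpow 2 ⊛ w) ⊕ a₃ · (w ⊛ w) ⊕ a₄ · (Z ⊛ (w ⊛ w))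
        ≈⟨ +-cong (+-cong (+-cong (+-cong Z³≈ (·≈ a₁ (Z ⊛ w))) (·≈ a₂ (zpow 2 ⊛ w) ⟨ ≈-trans ⟩ ⊛-congˡ (const a₂) (⊛-congʳ w Z²≈)))
                          (·≈ a₃ (w ⊛ w))) (·≈ a₄ (Z ⊛ (w ⊛ w))) ⟩
      Z ⊛ (Z ⊛ Z) ⊕ const a₁ ⊛ (Z ⊛ w) ⊕ const a₂ ⊛ ((Z ⊛ Z) ⊛ w) ⊕ const a₃ ⊛ (w ⊛ w) ⊕ const a₄ ⊛ (Z ⊛ (w ⊛ w))
        ≈⟨ solve 6 (λ z w α₁ α₂ α₃ α₄ →
             z :* (z :* z) :+ α₁ :* (z :* w) :+ α₂ :* ((z :* z) :* w) :+ α₃ :* (w :* w) :+ α₄ :* (z :* (w :* w))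
             := z :* (z :* z) :+ z :* (α₁ :+ α₂ :* z) :* w :+ (α₃ :+ α₄ :* z) :* (w :* w))
             ≈-refl Z w (const a₁) (const a₂) (const a₃) (const a₄) ⟩
      curveRHS w                                                           ∎
      where
      ·≈ : ∀ a f → a · f ≈[ N ] const a ⊛ f
      ·≈ a f = ≈-sym (≗⇒≈[] (const-⊛ a f))
      Z²≈ : zpow 2 ≈[ N ] Z ⊛ Z
      Z²≈ = ≗⇒≈[] (zmul≗Z⊛ Z)
      Z³≈ : zpow 3 ≈[ N ] Z ⊛ (Z ⊛ Z)
      Z³≈ = ≗⇒≈[] (zmul≗Z⊛ (zpow 2)) ⟨ ≈-trans ⟩ ⊛-congˡ Z Z²≈

    G²≈D : CurveEquation w N → G w ⊛ G w ≈[ N ] D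
    G²≈D curve = begin
      G w ⊛ G w                                                   ≈⟨ solve 6 (λ z w α₁ α₂ α₃ α₄ →
          let Aₚ = con (+ 1) :- z :* (α₁ :+ α₂ :* z)
              Mₚ = α₃ :+ α₄ :* z
          in (Aₚ :- con (+ 2) :* (Mₚ :* w)) :* (Aₚ :- con (+ 2) :* (Mₚ :* w))
          := Aₚ :* Aₚ :- con (+ 4) :* (z :* (z :* (z :* Mₚ)))
             :+ con (+ 4) :* Mₚ :* (z :* (z :* z) :+ z :* (α₁ :+ α₂ :* z) :* w :+ Mₚ :* (w :* w) :- w))
          ≈-refl Z w (const a₁) (const a₂) (const a₃) (const a₄) ⟩
      D ⊕ const (+ 4) ⊛ M ⊛ (curveRHS w ⊕ neg w)                  ≈⟨ ⊕-congˡ D (⊛-congˡ (const (+ 4) ⊛ M) (+-cong (≈-sym curve) (≈-refl {neg w}))) ⟩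
      D ⊕ const (+ 4) ⊛ M ⊛ (w ⊕ neg w)                           ≈⟨ solve 3 (λ d m w → d :+ m :* (w :- w) := d) ≈-refl D (const (+ 4) ⊛ M) w ⟩
      D                                                           ∎

    private
      δ-Z⊛ : ∀ f → δ (Z ⊛ f) ≈[ N ] Z ⊛ f ⊕ Z ⊛ δ f
      δ-Z⊛ f = ≗⇒≈[] (δ-⊛ Z f) ⟨ ≈-trans ⟩ ⊕-congʳ (Z ⊛ δ f) (⊛-congʳ f (≗⇒≈[] δ-Z))

      δ-linear : ∀ a b → δ (const a ⊕ const b ⊛ Z) ≈[ N ] 0ₛ ⊕ const b ⊛ Z
      δ-linear a b = ≗⇒≈[] (δ-⊕ (const a) (const b ⊛ Z))
        ⟨ ≈-trans ⟩ +-cong (≗⇒≈[] (δ-const a)) (≗⇒≈[] (δ-const⊛ b Z) ⟨ ≈-trans ⟩ ⊛-congˡ (const b) (≗⇒≈[] δ-Z))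

      δ-⊕₃ : ∀ f g h → δ (f ⊕ g ⊕ h) ≈[ N ] δ f ⊕ δ g ⊕ δ h
      δ-⊕₃ f g h = ≗⇒≈[] (δ-⊕ (f ⊕ g) h) ⟨ ≈-trans ⟩ ⊕-congʳ (δ h) (≗⇒≈[] (δ-⊕ f g))

    δ-curve : CurveEquation w N → δ w ≈[ N ] δcurveRHS w
    δ-curve curve = begin
      δ w                                                        ≈⟨ δ-cong curve ⟩
      δ (curveRHS w)                                             ≈⟨ δ-⊕₃ (Z ⊛ (Z ⊛ Z)) (E ⊛ w) (M ⊛ (w ⊛ w)) ⟩
      δ (Z ⊛ (Z ⊛ Z)) ⊕ δ (E ⊛ w) ⊕ δ (M ⊛ (w ⊛ w))            ≈⟨ +-cong (+-cong δZ³ δ[Ew]) δ[Mw²] ⟩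
      Z ⊛ (Z ⊛ Z) ⊕ Z ⊛ (Z ⊛ Z ⊕ Z ⊛ Z)
        ⊕ ((Z ⊛ L ⊕ Z ⊛ (0ₛ ⊕ const a₂ ⊛ Z)) ⊛ w ⊕ E ⊛ δ w)
        ⊕ ((0ₛ ⊕ const a₄ ⊛ Z) ⊛ (w ⊛ w) ⊕ M ⊛ (δ w ⊛ w ⊕ w ⊛ δ w))
                                                                 ≈⟨ solve 7 (λ z w v α₁ α₂ α₃ α₄ →
          let Lₚ = α₁ :+ α₂ :* z
              Mₚ = α₃ :+ α₄ :* z
          in z :* (z :* z) :+ z :* (z :* z :+ z :* z)
             :+ ((z :* Lₚ :+ z :* (con (+ 0) :+ α₂ :* z)) :* w :+ z :* Lₚ :* v)
             :+ ((con (+ 0) :+ α₄ :* z) :* (w :* w) :+ Mₚ :* (v :* w :+ w :* v))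
          := con (+ 3) :* (z :* (z :* z)) :+ (z :* (α₁ :+ con (+ 2) :* (α₂ :* z))) :* w :+ z :* Lₚ :* v
             :+ (α₄ :* z) :* (w :* w) :+ con (+ 2) :* (Mₚ :* (w :* v)))
          ≈-refl Z w (δ w) (const a₁) (const a₂) (const a₃) (const a₄) ⟩
      δcurveRHS w                                                ∎
      where
      δZ² : δ (Z ⊛ Z) ≈[ N ] Z ⊛ Z ⊕ Z ⊛ Z
      δZ² = δ-Z⊛ Z ⟨ ≈-trans ⟩ ⊕-congˡ (Z ⊛ Z) (⊛-congˡ Z (≗⇒≈[] δ-Z))
      δZ³ : δ (Z ⊛ (Z ⊛ Z)) ≈[ N ] Z ⊛ (Z ⊛ Z) ⊕ Z ⊛ (Z ⊛ Z ⊕ Z ⊛ Z)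
      δZ³ = δ-Z⊛ (Z ⊛ Z) ⟨ ≈-trans ⟩ ⊕-congˡ (Z ⊛ (Z ⊛ Z)) (⊛-congˡ Z δZ²)
      δ[Ew] : δ (E ⊛ w) ≈[ N ] (Z ⊛ L ⊕ Z ⊛ (0ₛ ⊕ const a₂ ⊛ Z)) ⊛ w ⊕ E ⊛ δ w
      δ[Ew] = ≗⇒≈[] (δ-⊛ E w) ⟨ ≈-trans ⟩ ⊕-congʳ (E ⊛ δ w) (⊛-congʳ w (δ-Z⊛ L ⟨ ≈-trans ⟩ ⊕-congˡ (Z ⊛ L) (⊛-congˡ Z (δ-linear a₁ a₂))))
      δ[Mw²] : δ (M ⊛ (w ⊛ w)) ≈[ N ] (0ₛ ⊕ const a₄ ⊛ Z) ⊛ (w ⊛ w) ⊕ M ⊛ (δ w ⊛ w ⊕ w ⊛ δ w)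
      δ[Mw²] = ≗⇒≈[] (δ-⊛ M (w ⊛ w)) ⟨ ≈-trans ⟩ +-cong (⊛-congʳ (w ⊛ w) (δ-linear a₃ a₄)) (⊛-congˡ M (≗⇒≈[] (δ-⊛ w w)))

    G⊛ωNum≈ωDen : CurveEquation w N → G w ⊛ ωNum w ≈[ N ] ωDen a₁ a₃ w
    G⊛ωNum≈ωDen curve = begin
      G w ⊛ (w ⊕ neg (δ w))                            ≈⟨ solve 7 (λ z w v α₁ α₂ α₃ α₄ →
          let Aₚ = con (+ 1) :- z :* (α₁ :+ α₂ :* z)
              Mₚ = α₃ :+ α₄ :* z
          in (Aₚ :- con (+ 2) :* (Mₚ :* w)) :* (w :- v)
          := (con (- + 2) :+ α₁ :* z :+ α₃ :* w) :* w
             :+ (con (+ 3) :* (w :- (z :* (z :* z) :+ z :* (α₁ :+ α₂ :* z) :* w :+ Mₚ :* (w :* w)))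
                 :- (v :- (con (+ 3) :* (z :* (z :* z)) :+ (z :* (α₁ :+ con (+ 2) :* (α₂ :* z))) :* w
                            :+ z :* (α₁ :+ α₂ :* z) :* v :+ (α₄ :* z) :* (w :* w) :+ con (+ 2) :* (Mₚ :* (w :* v))))))
          ≈-refl Z w (δ w) (const a₁) (const a₂) (const a₃) (const a₄) ⟩
      Q w ⊛ w ⊕ (const (+ 3) ⊛ (w ⊕ neg (curveRHS w)) ⊕ neg (δ w ⊕ neg (δcurveRHS w)))
                                                       ≈⟨ ⊕-congˡ (Q w ⊛ w) (+-cong (⊛-congˡ (const (+ 3)) (≈⇒−≈0 curve))
                                                                                   (-‿cong (≈⇒−≈0 (δ-curve curve)))) ⟩
      Q w ⊛ w ⊕ (const (+ 3) ⊛ 0ₛ ⊕ neg 0ₛ)            ≈⟨ solve 1 (λ x → x :+ (con (+ 3) :* con (+ 0) :- con (+ 0)) := x) ≈-refl (Q w ⊛ w) ⟩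
      Q w ⊛ w                                          ≈⟨ ⊛-congʳ w (≗⇒≈[] λ n → cong₂ _+_ (cong (_+_ (const (- + 2) n)) (const-⊛ a₁ Z n)) (const-⊛ a₃ w n)) ⟩
      ωDen a₁ a₃ w                                     ∎
      where
      ≈⇒−≈0 : ∀ {f g} → f ≈[ N ] g → f ⊕ neg g ≈[ N ] 0ₛ
      ≈⇒−≈0 {f} {g} f≈g = ⊕-congʳ (neg g) f≈g ⟨ ≈-trans ⟩ solve 1 (λ g → g :- g := con (+ 0)) ≈-refl g

module InverseSquareRoot (a₁ a₂ a₃ a₄ : ℤ) (N : ℕ) where
  open WeierstrassCurve a₁ a₂ a₃ a₄
  open InverseBinomialSeries {N} E E-order
  open TruncatedSeriesReasoning N

  -- ℒ b = 0 is the differential equation satisfied by D^(-1/2).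
  ℒ : PowerSeries → PowerSeries
  ℒ f = const (+ 2) ⊛ (D ⊛ δ f) ⊕ δ D ⊛ f

  ℒ-cong : ∀ {f g} → f ≈[ N ] g → ℒ f ≈[ N ] ℒ g
  ℒ-cong f≈g = +-cong (⊛-congˡ (const (+ 2)) (⊛-congˡ D (δ-cong f≈g))) (⊛-congˡ (δ D) f≈g)

  central : ℕ → ℕ
  central k = (2 ℕ.* k) C k

  -- With A⁻¹ = P 0, X k = Fᵏ A^-(2k+1) and V k = Fᵏ A^-(2k+1) δF + 2 Fᵏ⁺¹ A^-(2k+2) δE; then
  -- ℒ (X k) = 2k V (k-1) - 4(2k+1) V k, and the central binomial coefficients make ℒ B telescope.
  X V : ℕ → PowerSeries
  X k = F ^ₛ k ⊛ P (2 ℕ.* k)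
  V k = (F ^ₛ k ⊛ P (2 ℕ.* k)) ⊛ δ F ⊕ const (+ 2) ⊛ ((F ^ₛ suc k ⊛ P (suc (2 ℕ.* k))) ⊛ δ E)

  B : PowerSeries
  B = Σₛ N (λ k → const (+ central k) ⊛ X k)

  private
    δA : δ A ≈[ N ] 0ₛ ⊕ neg (δ E)
    δA = ≗⇒≈[] (δ-⊕ 1ₛ (neg E)) ⟨ ≈-trans ⟩ +-cong (≗⇒≈[] (δ-const (+ 1))) (≗⇒≈[] (δ-neg E))

    δD : δ D ≈[ N ] (0ₛ ⊕ neg (δ E)) ⊛ A ⊕ A ⊛ (0ₛ ⊕ neg (δ E)) ⊕ neg (const (+ 4) ⊛ δ F)
    δD = ≗⇒≈[] (δ-⊕ (A ⊛ A) (neg (const (+ 4) ⊛ F)))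
      ⟨ ≈-trans ⟩ +-cong (≗⇒≈[] (δ-⊛ A A) ⟨ ≈-trans ⟩ +-cong (⊛-congʳ A δA) (⊛-congˡ A δA))
                         (≗⇒≈[] (δ-neg (const (+ 4) ⊛ F)) ⟨ ≈-trans ⟩ -‿cong (≗⇒≈[] (δ-const⊛ (+ 4) F)))

  ℒ-X-zero : ℒ (X 0) ≈[ N ] neg (const (+ 4) ⊛ V 0)
  ℒ-X-zero = begin
    const (+ 2) ⊛ (D ⊛ δ (1ₛ ⊛ P 0)) ⊕ δ D ⊛ (1ₛ ⊛ P 0)
      ≈⟨ +-cong (⊛-congˡ (const (+ 2)) (⊛-congˡ D δX₀)) (*-cong δD (⊛-congˡ 1ₛ P₀≈)) ⟩
    const (+ 2) ⊛ (D ⊛ (0ₛ ⊛ (A ⊛ u) ⊕ 1ₛ ⊛ (const (+ 1) ⊛ (u ⊛ δ E))))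
      ⊕ ((0ₛ ⊕ neg (δ E)) ⊛ A ⊕ A ⊛ (0ₛ ⊕ neg (δ E)) ⊕ neg (const (+ 4) ⊛ δ F)) ⊛ (1ₛ ⊛ (A ⊛ u))
      ≈⟨ solve 5 (λ e f u δe δf →
           let Aₚ = con (+ 1) :- e
               δAₚ = con (+ 0) :- δe
           in con (+ 2) :* ((Aₚ :* Aₚ :- con (+ 4) :* f) :* (con (+ 0) :* (Aₚ :* u) :+ con (+ 1) :* (con (+ 1) :* (u :* δe))))
              :+ (δAₚ :* Aₚ :+ Aₚ :* δAₚ :- con (+ 4) :* δf) :* (con (+ 1) :* (Aₚ :* u))
           := :- (con (+ 4) :* ((con (+ 1) :* (Aₚ :* u)) :* δf :+ con (+ 2) :* ((f :* con (+ 1) :* u) :* δe))))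
           ≈-refl E F u (δ E) (δ F) ⟩
    neg (const (+ 4) ⊛ ((1ₛ ⊛ (A ⊛ u)) ⊛ δ F ⊕ const (+ 2) ⊛ ((F ⊛ 1ₛ ⊛ u) ⊛ δ E)))
      ≈⟨ -‿cong (⊛-congˡ (const (+ 4)) (⊕-congʳ (const (+ 2) ⊛ ((F ⊛ 1ₛ ⊛ u) ⊛ δ E)) (⊛-congʳ (δ F) (⊛-congˡ 1ₛ (≈-sym P₀≈))))) ⟩
    neg (const (+ 4) ⊛ V 0) ∎
    where
    u = P 1
    P₀≈ : P 0 ≈[ N ] A ⊛ u
    P₀≈ = ≈-sym (P-recurrence 0)
    δX₀ : δ (1ₛ ⊛ P 0) ≈[ N ] 0ₛ ⊛ (A ⊛ u) ⊕ 1ₛ ⊛ (const (+ 1) ⊛ (u ⊛ δ E))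
    δX₀ = ≗⇒≈[] (δ-⊛ 1ₛ (P 0)) ⟨ ≈-trans ⟩ +-cong (*-cong (≗⇒≈[] (δ-const (+ 1))) P₀≈) (⊛-congˡ 1ₛ (δ-P 0))

  ℒ-X-suc : ∀ k → let s = const (+ suc k) in
    ℒ (X (suc k)) ≈[ N ] const (+ 2) ⊛ (s ⊛ V k) ⊕ neg (const (+ 4) ⊛ ((const (+ 2) ⊛ s ⊕ 1ₛ) ⊛ V (suc k)))
  ℒ-X-suc k = begin
    const (+ 2) ⊛ (D ⊛ δ (F ^ₛ suc k ⊛ P q)) ⊕ δ D ⊛ (F ^ₛ suc k ⊛ P q)
      ≈⟨ +-cong (⊛-congˡ (const (+ 2)) (⊛-congˡ D δX)) (*-cong δD (⊛-congˡ (F ^ₛ suc k) Pq≈)) ⟩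
    const (+ 2) ⊛ (D ⊛ ((s ⊛ (Fᵏ ⊛ δ F)) ⊛ (A ⊛ u) ⊕ (F ⊛ Fᵏ) ⊛ ((const (+ 2) ⊛ s ⊕ 1ₛ) ⊛ (u ⊛ δ E))))
      ⊕ ((0ₛ ⊕ neg (δ E)) ⊛ A ⊕ A ⊛ (0ₛ ⊕ neg (δ E)) ⊕ neg (const (+ 4) ⊛ δ F)) ⊛ ((F ⊛ Fᵏ) ⊛ (A ⊛ u))
      ≈⟨ solve 7 (λ e f fᵏ u δe δf s →
           let Aₚ = con (+ 1) :- e
               δAₚ = con (+ 0) :- δe
               t = con (+ 2) :* s :+ con (+ 1)
           in con (+ 2) :* ((Aₚ :* Aₚ :- con (+ 4) :* f) :* ((s :* (fᵏ :* δf)) :* (Aₚ :* u) :+ (f :* fᵏ) :* (t :* (u :* δe))))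
              :+ (δAₚ :* Aₚ :+ Aₚ :* δAₚ :- con (+ 4) :* δf) :* ((f :* fᵏ) :* (Aₚ :* u))
           := con (+ 2) :* (s :* ((fᵏ :* (Aₚ :* (Aₚ :* (Aₚ :* u)))) :* δf :+ con (+ 2) :* (((f :* fᵏ) :* (Aₚ :* (Aₚ :* u))) :* δe)))
              :- con (+ 4) :* (t :* (((f :* fᵏ) :* (Aₚ :* u)) :* δf :+ con (+ 2) :* (((f :* (f :* fᵏ)) :* u) :* δe))))
           ≈-refl E F Fᵏ u (δ E) (δ F) s ⟩
    const (+ 2) ⊛ (s ⊛ ((Fᵏ ⊛ (A ⊛ (A ⊛ (A ⊛ u)))) ⊛ δ F ⊕ const (+ 2) ⊛ (((F ⊛ Fᵏ) ⊛ (A ⊛ (A ⊛ u))) ⊛ δ E)))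
      ⊕ neg (const (+ 4) ⊛ ((const (+ 2) ⊛ s ⊕ 1ₛ) ⊛ (((F ⊛ Fᵏ) ⊛ (A ⊛ u)) ⊛ δ F ⊕ const (+ 2) ⊛ (((F ⊛ (F ⊛ Fᵏ)) ⊛ u) ⊛ δ E))))
      ≈⟨ +-cong (⊛-congˡ (const (+ 2)) (⊛-congˡ s Vₖ≈))
                (-‿cong (⊛-congˡ (const (+ 4)) (⊛-congˡ (const (+ 2) ⊛ s ⊕ 1ₛ) Vₖ₊₁≈))) ⟩
    const (+ 2) ⊛ (s ⊛ V k) ⊕ neg (const (+ 4) ⊛ ((const (+ 2) ⊛ s ⊕ 1ₛ) ⊛ V (suc k))) ∎
    where
    q = 2 ℕ.* suc k
    u = P (suc q)
    s = const (+ suc k)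
    Fᵏ = F ^ₛ k
    Pq≈ : P q ≈[ N ] A ⊛ u
    Pq≈ = ≈-sym (P-recurrence q)
    P[1+2k]≈ : P (suc (2 ℕ.* k)) ≈[ N ] A ⊛ (A ⊛ u)
    P[1+2k]≈ = ≈-sym (P-recurrence (suc (2 ℕ.* k)))
      ⟨ ≈-trans ⟩ ⊛-congˡ A (≈-reflexive (cong P (sym (ℕₚ.*-suc 2 k))) ⟨ ≈-trans ⟩ Pq≈)
    P[2k]≈ : P (2 ℕ.* k) ≈[ N ] A ⊛ (A ⊛ (A ⊛ u))
    P[2k]≈ = ≈-sym (P-recurrence (2 ℕ.* k)) ⟨ ≈-trans ⟩ ⊛-congˡ A P[1+2k]≈
    1+q≈ : const (+ suc q) ≈[ N ] const (+ 2) ⊛ s ⊕ 1ₛ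
    1+q≈ = ≗⇒≈[] λ n → cong (λ m → const (+ m) n) (ℕₚ.+-comm 1 q)
      ⟨ trans ⟩ constℕ-+ q 1 n ⟨ trans ⟩ cong (_+ 1ₛ n) (constℕ-* 2 (suc k) n)
    δX : δ (F ^ₛ suc k ⊛ P q) ≈[ N ] (s ⊛ (Fᵏ ⊛ δ F)) ⊛ (A ⊛ u) ⊕ (F ⊛ Fᵏ) ⊛ ((const (+ 2) ⊛ s ⊕ 1ₛ) ⊛ (u ⊛ δ E))
    δX = ≗⇒≈[] (δ-⊛ (F ^ₛ suc k) (P q))
      ⟨ ≈-trans ⟩ +-cong (*-cong (δ-^ₛ F k) Pq≈) (⊛-congˡ (F ⊛ Fᵏ) (δ-P q ⟨ ≈-trans ⟩ ⊛-congʳ (u ⊛ δ E) 1+q≈))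
    Vₖ≈ : (Fᵏ ⊛ (A ⊛ (A ⊛ (A ⊛ u)))) ⊛ δ F ⊕ const (+ 2) ⊛ (((F ⊛ Fᵏ) ⊛ (A ⊛ (A ⊛ u))) ⊛ δ E) ≈[ N ] V k
    Vₖ≈ = +-cong (⊛-congʳ (δ F) (⊛-congˡ Fᵏ (≈-sym P[2k]≈)))
                 (⊛-congˡ (const (+ 2)) (⊛-congʳ (δ E) (⊛-congˡ (F ⊛ Fᵏ) (≈-sym P[1+2k]≈))))
    Vₖ₊₁≈ : ((F ⊛ Fᵏ) ⊛ (A ⊛ u)) ⊛ δ F ⊕ const (+ 2) ⊛ (((F ⊛ (F ⊛ Fᵏ)) ⊛ u) ⊛ δ E) ≈[ N ] V (suc k)
    Vₖ₊₁≈ = ⊕-congʳ (const (+ 2) ⊛ (((F ⊛ (F ⊛ Fᵏ)) ⊛ u) ⊛ δ E)) (⊛-congʳ (δ F) (⊛-congˡ (F ⊛ Fᵏ) (≈-sym Pq≈)))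

  Y : ℕ → PowerSeries
  Y zero    = 0ₛ
  Y (suc k) = const (+ (2 ℕ.* suc k ℕ.* central (suc k))) ⊛ V k

  private
    constℕ-cong : ∀ {a b} → a ≡ b → const (+ a) ≈[ N ] const (+ b)
    constℕ-cong a≡b = ≈-reflexive (cong (λ m → const (+ m)) a≡b)

    constℕ-*≈ : ∀ a b → const (+ (a ℕ.* b)) ≈[ N ] const (+ a) ⊛ const (+ b)
    constℕ-*≈ a b = ≗⇒≈[] (constℕ-* a b)

  central-step : ∀ k → 2 ℕ.* suc (suc k) ℕ.* central (suc (suc k)) ≡ 4 ℕ.* (2 ℕ.* suc k ℕ.+ 1) ℕ.* central (suc k)
  central-step k = ℕₚ.*-assoc 2 (suc (suc k)) (central (suc (suc k)))
    ⟨ trans ⟩ cong (2 ℕ.*_) ([1+n]*[2+2n]C[1+n]≡2*[1+2n]*[2n]Cn (suc k))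
    ⟨ trans ⟩ regroup (2 ℕ.* suc k) (central (suc k))
    where
    regroup : ∀ m c → 2 ℕ.* (2 ℕ.* suc m ℕ.* c) ≡ 4 ℕ.* (m ℕ.+ 1) ℕ.* c
    regroup = ℕ-Solver.solve-∀

  ℒ-const⊛ : ∀ a f → ℒ (const a ⊛ f) ≈[ N ] const a ⊛ ℒ f
  ℒ-const⊛ a f = begin
    const (+ 2) ⊛ (D ⊛ δ (const a ⊛ f)) ⊕ δ D ⊛ (const a ⊛ f)
      ≈⟨ ⊕-congʳ (δ D ⊛ (const a ⊛ f)) (⊛-congˡ (const (+ 2)) (⊛-congˡ D (≗⇒≈[] (δ-const⊛ a f)))) ⟩
    const (+ 2) ⊛ (D ⊛ (const a ⊛ δ f)) ⊕ δ D ⊛ (const a ⊛ f)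
      ≈⟨ solve 5 (λ d δd α f δf → con (+ 2) :* (d :* (α :* δf)) :+ δd :* (α :* f) := α :* (con (+ 2) :* (d :* δf) :+ δd :* f))
               ≈-refl D (δ D) (const a) f (δ f) ⟩
    const a ⊛ ℒ f ∎

  ℒ-summand-telescopes : ∀ k → ℒ (const (+ central k) ⊛ X k) ≈[ N ] 0ₛ ⊕ (Y k ⊕ neg (Y (suc k)))
  ℒ-summand-telescopes zero = begin
    ℒ (const (+ central 0) ⊛ X 0)          ≈⟨ ℒ-const⊛ (+ central 0) (X 0) ⟩
    const (+ central 0) ⊛ ℒ (X 0)          ≈⟨ ⊛-congˡ (const (+ central 0)) ℒ-X-zero ⟩
    const (+ 1) ⊛ neg (const (+ 4) ⊛ V 0)  ≈⟨ solve 1 (λ v → con (+ 1) :* :- (con (+ 4) :* v) := con (+ 0) :+ (con (+ 0) :- con (+ 4) :* v))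
                                                       ≈-refl (V 0) ⟩
    0ₛ ⊕ (Y 0 ⊕ neg (Y 1))                 ∎
  ℒ-summand-telescopes (suc k) = begin
    ℒ (const (+ c₁) ⊛ X (suc k))             ≈⟨ ℒ-const⊛ (+ c₁) (X (suc k)) ⟩
    const (+ c₁) ⊛ ℒ (X (suc k))             ≈⟨ ⊛-congˡ (const (+ c₁)) (ℒ-X-suc k) ⟩
    const (+ c₁) ⊛ (const (+ 2) ⊛ (s ⊛ V k) ⊕ neg (const (+ 4) ⊛ ((const (+ 2) ⊛ s ⊕ 1ₛ) ⊛ V (suc k))))
      ≈⟨ solve 4 (λ γ s v v′ →
           γ :* (con (+ 2) :* (s :* v) :- con (+ 4) :* ((con (+ 2) :* s :+ con (+ 1)) :* v′))
           := con (+ 0) :+ ((con (+ 2) :* s) :* γ :* v :- (con (+ 4) :* (con (+ 2) :* s :+ con (+ 1))) :* γ :* v′))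
           ≈-refl (const (+ c₁)) s (V k) (V (suc k)) ⟩
    0ₛ ⊕ ((const (+ 2) ⊛ s) ⊛ const (+ c₁) ⊛ V k ⊕ neg ((const (+ 4) ⊛ (const (+ 2) ⊛ s ⊕ 1ₛ)) ⊛ const (+ c₁) ⊛ V (suc k)))
      ≈⟨ ⊕-congˡ 0ₛ (+-cong (⊛-congʳ (V k) (≈-sym Yₖ₊₁-coeff)) (-‿cong (⊛-congʳ (V (suc k)) (≈-sym Yₖ₊₂-coeff)))) ⟩
    0ₛ ⊕ (Y (suc k) ⊕ neg (Y (suc (suc k)))) ∎
    where
    c₁ = central (suc k)
    s = const (+ suc k)
    Yₖ₊₁-coeff : const (+ (2 ℕ.* suc k ℕ.* c₁)) ≈[ N ] (const (+ 2) ⊛ s) ⊛ const (+ c₁)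
    Yₖ₊₁-coeff = constℕ-*≈ (2 ℕ.* suc k) c₁ ⟨ ≈-trans ⟩ ⊛-congʳ (const (+ c₁)) (constℕ-*≈ 2 (suc k))
    Yₖ₊₂-coeff : const (+ (2 ℕ.* suc (suc k) ℕ.* central (suc (suc k)))) ≈[ N ] (const (+ 4) ⊛ (const (+ 2) ⊛ s ⊕ 1ₛ)) ⊛ const (+ c₁)
    Yₖ₊₂-coeff = begin
      const (+ (2 ℕ.* suc (suc k) ℕ.* central (suc (suc k))))  ≈⟨ constℕ-cong (central-step k) ⟩
      const (+ (4 ℕ.* (2 ℕ.* suc k ℕ.+ 1) ℕ.* c₁))         ≈⟨ constℕ-*≈ (4 ℕ.* (2 ℕ.* suc k ℕ.+ 1)) c₁ ⟩
      const (+ (4 ℕ.* (2 ℕ.* suc k ℕ.+ 1))) ⊛ const (+ c₁) ≈⟨ ⊛-congʳ (const (+ c₁)) (constℕ-*≈ 4 (2 ℕ.* suc k ℕ.+ 1)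
                                                                ⟨ ≈-trans ⟩ ⊛-congˡ (const (+ 4)) (≗⇒≈[] (constℕ-+ (2 ℕ.* suc k) 1)
                                                                ⟨ ≈-trans ⟩ ⊕-congʳ 1ₛ (constℕ-*≈ 2 (suc k)))) ⟩
      (const (+ 4) ⊛ (const (+ 2) ⊛ s ⊕ 1ₛ)) ⊛ const (+ c₁) ∎

  Y-order : ∀ k → OrderAtLeast k (Y k)
  Y-order zero    _ ()
  Y-order (suc k) = const⊛-order _ (V k) (⊕-order
    (order-weaken (ℕₚ.≤-trans (ℕₚ.m≤m+n (suc k) (2 ℕ.* k ℕ.+ 2)) (ℕₚ.≤-reflexive (first k)))
      (⊛-order (⊛-order {g = P (2 ℕ.* k)} (^ₛ-order k F-order) (λ _ ())) (δ-order F-order)))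
    (const⊛-order (+ 2) _ (order-weaken (ℕₚ.≤-trans (ℕₚ.m≤m+n (suc k) (2 ℕ.* suc k)) (ℕₚ.≤-reflexive (second k)))
      (⊛-order {g = δ E} (⊛-order {g = P (suc (2 ℕ.* k))} (^ₛ-order (suc k) F-order) (λ _ ())) (λ _ ())))))
    where
    first : ∀ k → suc k ℕ.+ (2 ℕ.* k ℕ.+ 2) ≡ k ℕ.* 3 ℕ.+ 0 ℕ.+ 3
    first = ℕ-Solver.solve-∀
    second : ∀ k → suc k ℕ.+ 2 ℕ.* suc k ≡ suc k ℕ.* 3 ℕ.+ 0 ℕ.+ 0
    second = ℕ-Solver.solve-∀

  ℒ-Σₛ : ∀ K g → ℒ (Σₛ K g) ≈[ N ] Σₛ K (λ k → ℒ (g k))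
  ℒ-Σₛ K g = begin
    const (+ 2) ⊛ (D ⊛ δ (Σₛ K g)) ⊕ δ D ⊛ Σₛ K g
      ≈⟨ ⊕-congʳ (δ D ⊛ Σₛ K g) (⊛-congˡ (const (+ 2)) (⊛-congˡ D (≗⇒≈[] (δ-Σₛ K g)))) ⟩
    const (+ 2) ⊛ (D ⊛ Σₛ K (λ k → δ (g k))) ⊕ δ D ⊛ Σₛ K g
      ≈⟨ +-cong (⊛-congˡ (const (+ 2)) (≗⇒≈[] (⊛-distribˡ-Σₛ K D (λ k → δ (g k))))
                 ⟨ ≈-trans ⟩ ≗⇒≈[] (⊛-distribˡ-Σₛ K (const (+ 2)) (λ k → D ⊛ δ (g k))))
                (≗⇒≈[] (⊛-distribˡ-Σₛ K (δ D) g)) ⟩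
    Σₛ K (λ k → const (+ 2) ⊛ (D ⊛ δ (g k))) ⊕ Σₛ K (λ k → δ D ⊛ g k)
      ≈⟨ ≈-sym (≗⇒≈[] (Σₛ-distrib-⊕ K (λ k → const (+ 2) ⊛ (D ⊛ δ (g k))) (λ k → δ D ⊛ g k))) ⟩
    Σₛ K (λ k → ℒ (g k)) ∎

  B-ode : ℒ B ≈[ N ] 0ₛ
  B-ode = begin
    ℒ B                                         ≈⟨ ℒ-Σₛ N (λ k → const (+ central k) ⊛ X k) ⟩
    Σₛ N (λ k → ℒ (const (+ central k) ⊛ X k))  ≈⟨ Σₛ-telescoping Y ℒ-summand-telescopes (≈-refl {0ₛ}) (Y-order N) ⟩
    Σₛ N (λ _ → 0ₛ)                             ≈⟨ ≗⇒≈[] (λ n → sumBelow-zero N (λ _ _ → 0ₛ-coeff n) ⟨ trans ⟩ sym (0ₛ-coeff n)) ⟩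
    0ₛ                                          ∎

linear-⊛ : ∀ α β g n → ((const α ⊕ const β ⊛ Z) ⊛ g) n ≡ α * g n + β * zmul g n
linear-⊛ α β g n = ⊛-comm (const α ⊕ const β ⊛ Z) g n ⟨ trans ⟩ ⊛-distribˡ-⊕ g (const α) (const β ⊛ Z) n
  ⟨ trans ⟩ cong₂ _+_ (⊛-comm g (const α) n ⟨ trans ⟩ const-⊛ α g n)
                        (⊛-comm g (const β ⊛ Z) n ⟨ trans ⟩ ⊛-assoc (const β) Z g n ⟨ trans ⟩ const-⊛ β (Z ⊛ g) n
                          ⟨ trans ⟩ cong (β *_) (sym (zmul≗Z⊛ g n)))

linear-^ₛ : ∀ α β j r → ((const α ⊕ const β ⊛ Z) ^ₛ j) r ≡ + (j C r) * α ^ (j ∸ r) * β ^ r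
linear-^ₛ α β zero    zero    = refl
linear-^ₛ α β zero    (suc r) = refl
linear-^ₛ α β (suc j) zero = begin
  ((const α ⊕ const β ⊛ Z) ⊛ ℓʲ) 0               ≡⟨ linear-⊛ α β ℓʲ 0 ⟩
  α * ℓʲ 0 + β * + 0                             ≡⟨ cong (λ x → α * x + β * + 0) (linear-^ₛ α β j 0) ⟩
  α * (+ (j C 0) * α ^ j * + 1) + β * + 0        ≡⟨ cong (λ m → α * (+ m * α ^ j * + 1) + β * + 0) (nC0≡1 j) ⟩
  α * (+ 1 * α ^ j * + 1) + β * + 0              ≡⟨ regroup α β (α ^ j) ⟩
  + 1 * (α * α ^ j) * + 1                        ≡⟨ cong (λ m → + m * (α * α ^ j) * + 1) (nC0≡1 (suc j)) ⟨
  + (suc j C 0) * (α * α ^ j) * + 1              ∎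
  where
  open ≡-Reasoning
  ℓʲ = (const α ⊕ const β ⊛ Z) ^ₛ j
  regroup : ∀ a b x → a * (+ 1 * x * + 1) + b * + 0 ≡ + 1 * (a * x) * + 1
  regroup = solve-∀
linear-^ₛ α β (suc j) (suc r) = begin
  ((const α ⊕ const β ⊛ Z) ⊛ ℓʲ) (suc r)
    ≡⟨ linear-⊛ α β ℓʲ (suc r) ⟩
  α * ℓʲ (suc r) + β * ℓʲ r
    ≡⟨ cong₂ (λ x y → α * x + β * y) (linear-^ₛ α β j (suc r)) (linear-^ₛ α β j r) ⟩
  α * (+ (j C suc r) * α ^ (j ∸ suc r) * β ^ suc r) + β * (+ (j C r) * α ^ (j ∸ r) * β ^ r)
    ≡⟨ pascal-step ⟩
  (+ (j C r) + + (j C suc r)) * α ^ (j ∸ r) * β ^ suc r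
    ≡⟨ cong (λ x → x * α ^ (j ∸ r) * β ^ suc r) (sym (ℤₚ.pos-+ (j C r) (j C suc r)) ⟨ trans ⟩ cong +_ (nCk+nC[k+1]≡[n+1]C[k+1] j r)) ⟩
  + (suc j C suc r) * α ^ (j ∸ r) * β ^ suc r ∎
  where
  open ≡-Reasoning
  ℓʲ = (const α ⊕ const β ⊛ Z) ^ₛ j
  pascal-step : α * (+ (j C suc r) * α ^ (j ∸ suc r) * β ^ suc r) + β * (+ (j C r) * α ^ (j ∸ r) * β ^ r)
              ≡ (+ (j C r) + + (j C suc r)) * α ^ (j ∸ r) * β ^ suc r
  pascal-step with r ℕₚ.<? j
  ... | yes r<j = cong (λ e → α * (+ (j C suc r) * α ^ (j ∸ suc r) * β ^ suc r) + β * (+ (j C r) * α ^ e * β ^ r)) j∸r≡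
      ⟨ trans ⟩ regroup α β (+ (j C r)) (+ (j C suc r)) (α ^ (j ∸ suc r)) (β ^ r)
      ⟨ trans ⟩ cong (λ e → (+ (j C r) + + (j C suc r)) * α ^ e * β ^ suc r) (sym j∸r≡)
    where
    j∸r≡ : j ∸ r ≡ suc (j ∸ suc r)
    j∸r≡ = ℕₚ.+-∸-assoc 1 r<j
    regroup : ∀ a b c₀ c₁ x y → a * (c₁ * x * (b * y)) + b * (c₀ * (a * x) * y) ≡ (c₀ + c₁) * (a * x) * (b * y)
    regroup = solve-∀
  ... | no r≮j = cong (λ m → α * (+ m * α ^ (j ∸ suc r) * β ^ suc r) + β * (+ (j C r) * α ^ (j ∸ r) * β ^ r)) jC[1+r]≡0
      ⟨ trans ⟩ regroup α β (+ (j C r)) (α ^ (j ∸ suc r)) (α ^ (j ∸ r)) (β ^ r)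
      ⟨ trans ⟩ cong (λ m → (+ (j C r) + + m) * α ^ (j ∸ r) * β ^ suc r) (sym jC[1+r]≡0)
    where
    jC[1+r]≡0 : j C suc r ≡ 0
    jC[1+r]≡0 = k>n⇒nCk≡0 (s≤s (ℕₚ.≮⇒≥ r≮j))
    regroup : ∀ a b c₀ x x′ y → a * (+ 0 * x * (b * y)) + b * (c₀ * x′ * y) ≡ (c₀ + + 0) * x′ * (b * y)
    regroup = solve-∀

module CoefficientsOfB (a₁ a₂ a₃ a₄ : ℤ) {N : ℕ} (n : ℕ) (n<N : n < N) where
  open WeierstrassCurve a₁ a₂ a₃ a₄
  open InverseSquareRoot a₁ a₂ a₃ a₄ N
  open InverseBinomialSeries {N} E E-order using (P)

  W : ℕ → ℕ → ℤ
  W j k = (E ^ₛ j ⊛ F ^ₛ k) n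

  EʲFᵏ≈ : ∀ j k → E ^ₛ j ⊛ F ^ₛ k ≈[ N ] zpow (j ℕ.+ k ℕ.* 3) ⊛ (L ^ₛ j ⊛ M ^ₛ k)
  EʲFᵏ≈ j k = begin
    E ^ₛ j ⊛ F ^ₛ k                                      ≈⟨ *-cong (zpow⊛-^ₛ 1 L j) (^ₛ-cong k F≈ ⟨ ≈-trans ⟩ zpow⊛-^ₛ 3 M k) ⟩
    (zpow (j ℕ.* 1) ⊛ L ^ₛ j) ⊛ (zpow (k ℕ.* 3) ⊛ M ^ₛ k) ≈⟨ solve 4 (λ x l y m → (x :* l) :* (y :* m) := (x :* y) :* (l :* m))
                                                              ≈-refl (zpow (j ℕ.* 1)) (L ^ₛ j) (zpow (k ℕ.* 3)) (M ^ₛ k) ⟩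
    (zpow (j ℕ.* 1) ⊛ zpow (k ℕ.* 3)) ⊛ (L ^ₛ j ⊛ M ^ₛ k) ≈⟨ ⊛-congʳ (L ^ₛ j ⊛ M ^ₛ k) (≈-sym (zpow-+ (j ℕ.* 1) (k ℕ.* 3))) ⟩
    zpow (j ℕ.* 1 ℕ.+ k ℕ.* 3) ⊛ (L ^ₛ j ⊛ M ^ₛ k)        ≈⟨ ≈-reflexive (cong (λ d → zpow (d ℕ.+ k ℕ.* 3) ⊛ (L ^ₛ j ⊛ M ^ₛ k)) (ℕₚ.*-identityʳ j)) ⟩
    zpow (j ℕ.+ k ℕ.* 3) ⊛ (L ^ₛ j ⊛ M ^ₛ k)              ∎
    where
    open TruncatedSeriesReasoning N
    F≈ : F ≈[ N ] zpow 3 ⊛ M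
    F≈ = begin
      Z ⊛ (Z ⊛ (Z ⊛ M))       ≈⟨ solve 2 (λ z m → z :* (z :* (z :* m)) := (z :* (z :* z)) :* m) ≈-refl Z M ⟩
      (Z ⊛ (Z ⊛ Z)) ⊛ M       ≈⟨ ⊛-congʳ M (≈-sym (≗⇒≈[] (zmul≗Z⊛ (zpow 2)) ⟨ ≈-trans ⟩ ⊛-congˡ Z (≗⇒≈[] (zmul≗Z⊛ Z)))) ⟩
      zpow 3 ⊛ M               ∎

  W-expansion : ∀ j k → let d = j ℕ.+ k ℕ.* 3 in
    W j k ≡ sumBelow (suc n ∸ d) (λ r → (L ^ₛ j) r * (M ^ₛ k) (n ∸ d ∸ r))
  W-expansion j k = agreement (EʲFᵏ≈ j k) n n<N ⟨ trans ⟩ shift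
    where
    d = j ℕ.+ k ℕ.* 3
    h = L ^ₛ j ⊛ M ^ₛ k
    shift : (zpow d ⊛ h) n ≡ sumBelow (suc n ∸ d) (λ r → (L ^ₛ j) r * (M ^ₛ k) (n ∸ d ∸ r))
    shift with d ℕₚ.≤? n
    ... | yes d≤n = cong (zpow d ⊛ h) (sym (ℕₚ.m+[n∸m]≡n d≤n)) ⟨ trans ⟩ zpow-⊛-shift d h (n ∸ d)
                    ⟨ trans ⟩ cong (λ t → sumBelow t (λ r → (L ^ₛ j) r * (M ^ₛ k) (n ∸ d ∸ r))) (sym (ℕₚ.+-∸-assoc 1 d≤n))
    ... | no  d≰n = zpow-⊛-low d h n (ℕₚ.≰⇒> d≰n)
                    ⟨ trans ⟩ cong (λ t → sumBelow t (λ r → (L ^ₛ j) r * (M ^ₛ k) (n ∸ d ∸ r))) (sym (ℕₚ.m≤n⇒m∸n≡0 (ℕₚ.≰⇒> d≰n)))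

  W-high : ∀ {j k} → n < j ℕ.+ k ℕ.* 3 → W j k ≡ + 0
  W-high {j} {k} n<d = W-expansion j k
    ⟨ trans ⟩ cong (λ t → sumBelow t (λ r → (L ^ₛ j) r * (M ^ₛ k) (n ∸ (j ℕ.+ k ℕ.* 3) ∸ r))) (ℕₚ.m≤n⇒m∸n≡0 n<d)

  W-low : ∀ {j k} → j ℕ.* 2 ℕ.+ k ℕ.* 4 < n → W j k ≡ + 0
  W-low {j} {k} = ⊛-degree {f = E ^ₛ j} {g = F ^ₛ k} (^ₛ-degree {f = E} j E-degree) (^ₛ-degree {f = F} k F-degree) n
    where
    E-degree : DegreeAtMost 2 E
    E-degree = ⊛-degree {1} {f = Z} {g = L} Z-degree (linear-degree a₁ a₂)
    F-degree : DegreeAtMost 4 F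
    F-degree = ⊛-degree {1} {f = Z} Z-degree (⊛-degree {1} {f = Z} Z-degree (⊛-degree {1} {f = Z} {g = M} Z-degree (linear-degree a₃ a₄)))

  binW : ℕ → ℕ → ℤ
  binW m k = + (m C (2 ℕ.* k)) * W (m ∸ 2 ℕ.* k) k

  binW-below : ∀ m k → m < 2 ℕ.* k → binW m k ≡ + 0
  binW-below m k m<2k = cong (λ b → + b * W (m ∸ 2 ℕ.* k) k) (k>n⇒nCk≡0 m<2k)

  binW-above : ∀ m k → n < m → binW m k ≡ + 0
  binW-above m k n<m with 2 ℕ.* k ℕ.≤? m
  ... | no  2k≰m = binW-below m k (ℕₚ.≰⇒> 2k≰m)
  ... | yes 2k≤m = cong (+ (m C (2 ℕ.* k)) *_) (W-high {m ∸ 2 ℕ.* k} {k} (ℕₚ.<-≤-trans n<m m≤))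
                   ⟨ trans ⟩ ℤₚ.*-zeroʳ (+ (m C (2 ℕ.* k)))
    where
    m≤ : m ≤ m ∸ 2 ℕ.* k ℕ.+ k ℕ.* 3
    m≤ = ℕₚ.≤-trans (ℕₚ.≤-reflexive (sym (ℕₚ.m∸n+n≡m 2k≤m)))
           (ℕₚ.+-monoʳ-≤ (m ∸ 2 ℕ.* k) (ℕₚ.≤-trans (ℕₚ.≤-reflexive (ℕₚ.*-comm 2 k)) (ℕₚ.*-monoʳ-≤ k (s≤s (s≤s z≤n)))))

  summand : ℕ → ℕ → ℤ
  summand m k = + central k * binW m k

  B-coeff-expanded : B n ≡ sumBelow N (λ k → + central k * sumBelow N (λ j → + ((2 ℕ.* k ℕ.+ j) C (2 ℕ.* k)) * W j k))
  B-coeff-expanded = sumBelow-cong N λ k _ →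
    const-⊛ (+ central k) (X k) n ⟨ trans ⟩ cong (+ central k *_) (⊛-distribˡ-Σₛ N (F ^ₛ k) (λ j → Cₖ k j ⊛ E ^ₛ j) n
      ⟨ trans ⟩ sumBelow-cong N λ j _ → ⊛-comm (F ^ₛ k) (Cₖ k j ⊛ E ^ₛ j) n
        ⟨ trans ⟩ ⊛-assoc (Cₖ k j) (E ^ₛ j) (F ^ₛ k) n ⟨ trans ⟩ const-⊛ (+ ((2 ℕ.* k ℕ.+ j) C (2 ℕ.* k))) (E ^ₛ j ⊛ F ^ₛ k) n)
    where
    Cₖ : ℕ → ℕ → PowerSeries
    Cₖ k j = const (+ ((2 ℕ.* k ℕ.+ j) C (2 ℕ.* k)))

  reindex : ∀ k → sumBelow N (λ j → + ((2 ℕ.* k ℕ.+ j) C (2 ℕ.* k)) * W j k) ≡ sumBelow N (λ m → binW m k)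
  reindex k = sym (begin
    sumBelow N (λ m → binW m k)                   ≡⟨ sumBelow-dropʳ (ℕₚ.m≤n+m N (2 ℕ.* k)) (λ m N≤m _ → binW-above m k (ℕₚ.<-≤-trans n<N N≤m)) ⟨
    sumBelow (2 ℕ.* k ℕ.+ N) (λ m → binW m k)     ≡⟨ sumBelow-dropˡ (2 ℕ.* k) N (λ m → binW-below m k) ⟩
    sumBelow N (λ j → binW (2 ℕ.* k ℕ.+ j) k)     ≡⟨ sumBelow-cong N (λ j _ → cong (λ i → + ((2 ℕ.* k ℕ.+ j) C (2 ℕ.* k)) * W i k)
                                                                              (ℕₚ.m+n∸m≡n (2 ℕ.* k) j)) ⟩
    sumBelow N (λ j → + ((2 ℕ.* k ℕ.+ j) C (2 ℕ.* k)) * W j k) ∎)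
    where open ≡-Reasoning

  B-coeff-reindexed : B n ≡ sumBelow N (λ m → sumBelow N (λ k → summand m k))
  B-coeff-reindexed = B-coeff-expanded
    ⟨ trans ⟩ sumBelow-cong N (λ k _ → cong (+ central k *_) (reindex k) ⟨ trans ⟩ *-distribˡ-sumBelow N (+ central k) (λ m → binW m k))
    ⟨ trans ⟩ sumBelow-swap N N (λ k m → summand m k)

  private
    m/2<k⇒m<2k : ∀ {m k} → m / 2 < k → m < 2 ℕ.* k
    m/2<k⇒m<2k {m} {k} m/2<k = ℕₚ.≰⇒> λ 2k≤m → ℕₚ.<⇒≱ m/2<k
      (subst (_≤ m / 2) (cong (_/ 2) (ℕₚ.*-comm 2 k) ⟨ trans ⟩ m*n/n≡m k 2) (/-monoˡ-≤ 2 2k≤m))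

    k≤m/2⇒2k≤m : ∀ {m k} → k < suc (m / 2) → 2 ℕ.* k ≤ m
    k≤m/2⇒2k≤m {m} {k} (s≤s k≤m/2) =
      ℕₚ.≤-trans (ℕₚ.≤-reflexive (ℕₚ.*-comm 2 k)) (ℕₚ.≤-trans (ℕₚ.*-monoˡ-≤ 2 k≤m/2) (m/n*n≤m m 2))

  row : ℕ → ℤ
  row m = sumBelow (suc (m / 2)) (summand m)

  restrict-k : ∀ m → m < N → sumBelow N (summand m) ≡ row m
  restrict-k m m<N = sumBelow-dropʳ (ℕₚ.≤-<-trans (m/n≤m m 2) m<N) λ k 1+m/2≤k _ →
    cong (+ central k *_) (binW-below m k (m/2<k⇒m<2k 1+m/2≤k)) ⟨ trans ⟩ ℤₚ.*-zeroʳ (+ central k)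

  restrict-top : sumBelow N row ≡ sumBelow (suc n) row
  restrict-top = sumBelow-dropʳ n<N λ m n<m _ → sumBelow-zero (suc (m / 2)) λ k _ →
    cong (+ central k *_) (binW-above m k n<m) ⟨ trans ⟩ ℤₚ.*-zeroʳ (+ central k)

  -- Eʲ Fᵏ has degree at most 2j + 4k = 2m: this is the lower limit ⌊n/2⌋ of the paper's sum.
  restrict-m : sumBelow (suc n) row ≡ sumBelow (suc n ∸ n / 2) (λ i → row (n / 2 ℕ.+ i))
  restrict-m = cong (λ l → sumBelow l row) (sym (ℕₚ.m+[n∸m]≡n (ℕₚ.≤-trans (m/n≤m n 2) (ℕₚ.n≤1+n n))))
    ⟨ trans ⟩ sumBelow-dropˡ (n / 2) (suc n ∸ n / 2) λ m m<n/2 → sumBelow-zero (suc (m / 2)) λ k k≤m/2 →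
      cong (λ x → + central k * (+ (m C (2 ℕ.* k)) * x)) (W-low {m ∸ 2 ℕ.* k} {k} (degree<n m k m<n/2 (k≤m/2⇒2k≤m k≤m/2)))
      ⟨ trans ⟩ cong (+ central k *_) (ℤₚ.*-zeroʳ (+ (m C (2 ℕ.* k)))) ⟨ trans ⟩ ℤₚ.*-zeroʳ (+ central k)
    where
    degree<n : ∀ m k → m < n / 2 → 2 ℕ.* k ≤ m → (m ∸ 2 ℕ.* k) ℕ.* 2 ℕ.+ k ℕ.* 4 < n
    degree<n m k m<n/2 2k≤m = ℕₚ.≤-trans (ℕₚ.≤-reflexive (cong suc (regroup (m ∸ 2 ℕ.* k) k ⟨ trans ⟩ cong (ℕ._* 2) (ℕₚ.m∸n+n≡m 2k≤m))))
      (ℕₚ.≤-trans (ℕₚ.≤-trans (ℕₚ.n≤1+n _) (ℕₚ.*-monoˡ-≤ 2 m<n/2)) (m/n*n≤m n 2))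
      where
      regroup : ∀ j k → j ℕ.* 2 ℕ.+ k ℕ.* 4 ≡ (j ℕ.+ 2 ℕ.* k) ℕ.* 2
      regroup = ℕ-Solver.solve-∀

  bCoef-inner : ℕ → ℕ → ℤ
  bCoef-inner m k = sumBelow (suc n ∸ (m ℕ.+ k)) λ r →
    + ((m C k) ℕ.* ((m ∸ k) C k) ℕ.* ((m ∸ 2 ℕ.* k) C r) ℕ.* (k C (n ∸ m ∸ k ∸ r)))
    * (a₁ ^ (m ∸ 2 ℕ.* k ∸ r)) * (a₂ ^ r)
    * (a₃ ^ ((2 ℕ.* k ℕ.+ m ℕ.+ r) ∸ n)) * (a₄ ^ (n ∸ m ∸ k ∸ r))

  summand≡bCoef-inner : ∀ m k → 2 ℕ.* k ≤ m → summand m k ≡ bCoef-inner m k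
  summand≡bCoef-inner m k 2k≤m = begin
    + central k * (+ Cₘ * W j k)
      ≡⟨ cong (λ x → + central k * (+ Cₘ * x)) (W-expansion j k ⟨ trans ⟩ cong (λ d → sumBelow (suc n ∸ d) (term d)) d≡m+k) ⟩
    + central k * (+ Cₘ * sumBelow (suc n ∸ (m ℕ.+ k)) (term (m ℕ.+ k)))
      ≡⟨ cong (+ central k *_) (*-distribˡ-sumBelow (suc n ∸ (m ℕ.+ k)) (+ Cₘ) (term (m ℕ.+ k)))
         ⟨ trans ⟩ *-distribˡ-sumBelow (suc n ∸ (m ℕ.+ k)) (+ central k) (λ r → + Cₘ * term (m ℕ.+ k) r) ⟩
    sumBelow (suc n ∸ (m ℕ.+ k)) (λ r → + central k * (+ Cₘ * term (m ℕ.+ k) r))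
      ≡⟨ sumBelow-cong (suc n ∸ (m ℕ.+ k)) term≡ ⟩
    bCoef-inner m k ∎
    where
    open ≡-Reasoning
    j = m ∸ 2 ℕ.* k
    Cₘ = m C (2 ℕ.* k)
    term : ℕ → ℕ → ℤ
    term d r = (L ^ₛ j) r * (M ^ₛ k) (n ∸ d ∸ r)
    d≡m+k : j ℕ.+ k ℕ.* 3 ≡ m ℕ.+ k
    d≡m+k = cong (j ℕ.+_) (3k≡2k+k k) ⟨ trans ⟩ sym (ℕₚ.+-assoc j (2 ℕ.* k) k) ⟨ trans ⟩ cong (ℕ._+ k) (ℕₚ.m∸n+n≡m 2k≤m)
      where
      3k≡2k+k : ∀ k → k ℕ.* 3 ≡ 2 ℕ.* k ℕ.+ k
      3k≡2k+k = ℕ-Solver.solve-∀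
    term≡ : ∀ r → r < suc n ∸ (m ℕ.+ k) →
      + central k * (+ Cₘ * term (m ℕ.+ k) r) ≡
      + ((m C k) ℕ.* ((m ∸ k) C k) ℕ.* (j C r) ℕ.* (k C (n ∸ m ∸ k ∸ r)))
      * (a₁ ^ (j ∸ r)) * (a₂ ^ r) * (a₃ ^ ((2 ℕ.* k ℕ.+ m ℕ.+ r) ∸ n)) * (a₄ ^ (n ∸ m ∸ k ∸ r))
    term≡ r r<1+n∸[m+k] = begin
      + central k * (+ Cₘ * ((L ^ₛ j) r * (M ^ₛ k) s))
        ≡⟨ cong₂ (λ x y → + central k * (+ Cₘ * (x * y))) (linear-^ₛ a₁ a₂ j r) (linear-^ₛ a₃ a₄ k s) ⟩
      + central k * (+ Cₘ * ((+ (j C r) * a₁ ^ (j ∸ r) * a₂ ^ r) * (+ (k C s) * a₃ ^ (k ∸ s) * a₄ ^ s)))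
        ≡⟨ by-cases ⟩
      + (central k ℕ.* Cₘ ℕ.* (j C r) ℕ.* (k C s)) * a₁ ^ (j ∸ r) * a₂ ^ r * a₃ ^ e * a₄ ^ s
        ≡⟨ cong₂ (λ x y → + (x ℕ.* (j C r) ℕ.* (k C y)) * a₁ ^ (j ∸ r) * a₂ ^ r * a₃ ^ e * a₄ ^ y)
                 (sym (mCk*[m∸k]Ck≡[2k]Ck*mC[2k] {m} {k} 2k≤m)) (sym s≡) ⟩
      + ((m C k) ℕ.* ((m ∸ k) C k) ℕ.* (j C r) ℕ.* (k C (n ∸ m ∸ k ∸ r)))
        * a₁ ^ (j ∸ r) * a₂ ^ r * a₃ ^ e * a₄ ^ (n ∸ m ∸ k ∸ r) ∎
      where
      s = n ∸ (m ℕ.+ k) ∸ r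
      e = (2 ℕ.* k ℕ.+ m ℕ.+ r) ∸ n
      s≡ : n ∸ m ∸ k ∸ r ≡ s
      s≡ = cong (_∸ r) (ℕₚ.∸-+-assoc n m k)
      by-cases : + central k * (+ Cₘ * ((+ (j C r) * a₁ ^ (j ∸ r) * a₂ ^ r) * (+ (k C s) * a₃ ^ (k ∸ s) * a₄ ^ s)))
               ≡ + (central k ℕ.* Cₘ ℕ.* (j C r) ℕ.* (k C s)) * a₁ ^ (j ∸ r) * a₂ ^ r * a₃ ^ e * a₄ ^ s
      by-cases with s ℕₚ.≤? k
      ... | yes s≤k = regroup (+ central k) (+ Cₘ) (+ (j C r)) (+ (k C s)) (a₁ ^ (j ∸ r)) (a₂ ^ r) (a₃ ^ (k ∸ s)) (a₄ ^ s)
            ⟨ trans ⟩ cong₂ (λ x y → x * a₁ ^ (j ∸ r) * a₂ ^ r * a₃ ^ y * a₄ ^ s) (sym pos-*⁴) (sym e≡k∸s)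
        where
        regroup : ∀ c C x y p q u v → c * (C * ((x * p * q) * (y * u * v))) ≡ c * C * x * y * p * q * u * v
        regroup = solve-∀
        pos-*⁴ : + (central k ℕ.* Cₘ ℕ.* (j C r) ℕ.* (k C s)) ≡ + central k * + Cₘ * + (j C r) * + (k C s)
        pos-*⁴ = ℤₚ.pos-* (central k ℕ.* Cₘ ℕ.* (j C r)) (k C s)
          ⟨ trans ⟩ cong (_* + (k C s)) (ℤₚ.pos-* (central k ℕ.* Cₘ) (j C r) ⟨ trans ⟩ cong (_* + (j C r)) (ℤₚ.pos-* (central k) Cₘ))
        r+[m+k]≤n : r ℕ.+ (m ℕ.+ k) ≤ n
        r+[m+k]≤n = <∸⇒+≤ r<1+n∸[m+k]
        n≡ : n ≡ s ℕ.+ (r ℕ.+ (m ℕ.+ k))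
        n≡ = sym (sym (ℕₚ.+-assoc s r (m ℕ.+ k))
               ⟨ trans ⟩ cong (ℕ._+ (m ℕ.+ k)) (ℕₚ.m∸n+n≡m (ℕₚ.m+n≤o⇒m≤o∸n r r+[m+k]≤n))
               ⟨ trans ⟩ ℕₚ.m∸n+n≡m (ℕₚ.≤-trans (ℕₚ.m≤n+m (m ℕ.+ k) r) r+[m+k]≤n))
        e≡k∸s : e ≡ k ∸ s
        e≡k∸s = cong₂ _∸_ (cong (λ x → 2 ℕ.* x ℕ.+ m ℕ.+ r) (sym (ℕₚ.m∸n+n≡m s≤k)) ⟨ trans ⟩ regroupℕ (k ∸ s) s m r) n≡
                ⟨ trans ⟩ cong (λ x → (k ∸ s) ℕ.+ (s ℕ.+ (r ℕ.+ (m ℕ.+ x))) ∸ (s ℕ.+ (r ℕ.+ (m ℕ.+ k)))) (ℕₚ.m∸n+n≡m s≤k)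
                ⟨ trans ⟩ ℕₚ.m+n∸n≡m (k ∸ s) (s ℕ.+ (r ℕ.+ (m ℕ.+ k)))
          where
          regroupℕ : ∀ u s m r → 2 ℕ.* (u ℕ.+ s) ℕ.+ m ℕ.+ r ≡ u ℕ.+ (s ℕ.+ (r ℕ.+ (m ℕ.+ (u ℕ.+ s))))
          regroupℕ = ℕ-Solver.solve-∀
      ... | no  s≰k = cong (λ b → + central k * (+ Cₘ * (ℓ * (+ b * a₃ ^ (k ∸ s) * a₄ ^ s)))) kCs≡0
            ⟨ trans ⟩ cong (λ x → + central k * (+ Cₘ * x)) (ℤₚ.*-zeroʳ ℓ) ⟨ trans ⟩ cong (+ central k *_) (ℤₚ.*-zeroʳ (+ Cₘ))
            ⟨ trans ⟩ ℤₚ.*-zeroʳ (+ central k)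
            ⟨ trans ⟩ cong (λ b → + b * a₁ ^ (j ∸ r) * a₂ ^ r * a₃ ^ e * a₄ ^ s)
                             (sym (cong (central k ℕ.* Cₘ ℕ.* (j C r) ℕ.*_) kCs≡0 ⟨ trans ⟩ ℕₚ.*-zeroʳ (central k ℕ.* Cₘ ℕ.* (j C r))))
        where
        ℓ = + (j C r) * a₁ ^ (j ∸ r) * a₂ ^ r
        kCs≡0 : k C s ≡ 0
        kCs≡0 = k>n⇒nCk≡0 (ℕₚ.≰⇒> s≰k)

  B-coeff≡bCoef : B n ≡ bCoef a₁ a₂ a₃ a₄ n
  B-coeff≡bCoef = begin
    B n                                                 ≡⟨ B-coeff-reindexed ⟩
    sumBelow N (λ m → sumBelow N (summand m))           ≡⟨ sumBelow-cong N restrict-k ⟩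
    sumBelow N row                                      ≡⟨ restrict-top ⟩
    sumBelow (suc n) row                                ≡⟨ restrict-m ⟩
    sumBelow (suc n ∸ n / 2) (λ i → row (n / 2 ℕ.+ i))  ≡⟨ sumBelow-cong (suc n ∸ n / 2) (λ i _ → sumBelow-cong (suc ((n / 2 ℕ.+ i) / 2))
                                                             (λ k k≤m/2 → summand≡bCoef-inner (n / 2 ℕ.+ i) k (k≤m/2⇒2k≤m k≤m/2))) ⟩
    bCoef a₁ a₂ a₃ a₄ n                                 ∎
    where open ≡-Reasoning

theorem3 : (a₁ a₂ a₃ a₄ : ℤ) → discriminant a₁ a₂ a₃ a₄ ≢ + 0 →
           (w : PowerSeries) → IsFormalW a₁ a₂ a₃ a₄ w →
           ∀ n → (bCoef a₁ a₂ a₃ a₄ ⊛ ωDen a₁ a₃ w) n ≡ ωNum w n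
theorem3 a₁ a₂ a₃ a₄ _ w formalW@(w₀≡0 , _) n = agreement bωDen≈ωNum n ℕₚ.≤-refl
  where
  open WeierstrassCurve a₁ a₂ a₃ a₄
  open InverseSquareRoot a₁ a₂ a₃ a₄ (suc n)
  open TruncatedSeriesReasoning (suc n)
  b = bCoef a₁ a₂ a₃ a₄
  curve : CurveEquation w (suc n)
  curve = IsFormalW⇒CurveEquation w formalW
  b≈B : b ≈[ suc n ] B
  b≈B = agreeBelow λ m m<1+n → sym (CoefficientsOfB.B-coeff≡bCoef a₁ a₂ a₃ a₄ m m<1+n)
  -- b 0 reduces to + 1.
  bG≈1 : b ⊛ G w ≈[ suc n ] 1ₛ
  bG≈1 = 2Dδb+[δD]b≈0⇒bG≈1 D (G w) b (G²≈D w curve) (ℒ-cong b≈B ⟨ ≈-trans ⟩ B-ode) (cong (b 0 *_) (G₀≡1 w w₀≡0))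
  bωDen≈ωNum : b ⊛ ωDen a₁ a₃ w ≈[ suc n ] ωNum w
  bωDen≈ωNum = begin
    b ⊛ ωDen a₁ a₃ w        ≈⟨ ⊛-congˡ b (≈-sym (G⊛ωNum≈ωDen w curve)) ⟩
    b ⊛ (G w ⊛ ωNum w)      ≈⟨ ≈-sym (≗⇒≈[] (⊛-assoc b (G w) (ωNum w))) ⟩
    (b ⊛ G w) ⊛ ωNum w      ≈⟨ ⊛-congʳ (ωNum w) bG≈1 ⟩
    1ₛ ⊛ ωNum w             ≈⟨ ≗⇒≈[] (⊛-identityˡ (ωNum w)) ⟩
    ωNum w                  ∎
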